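{- Let $p$ be an odd prime and $j\in\{1,4,8\}$ such that $8x^2+27y^2=jp$ has a solution $(x,y)\in\mathbb{Z}^2$ with $\gcd(x,y)=1$. Let $m$ be a positive integer with $p\nmid m$ and $pm\equiv 11\pmod{24}$, and let $U_{p,m}=\{(u,v)\in\mathbb{Z}^2: 8u^2+27v^2=pm,\ \gcd(u,v)=1\}$. If $m>1$ then $|U_{p,m}|\equiv 0\pmod 8$, and if $m=1$ then $|U_{p,1}|=4$. -}

module Defs where

open import Data.Nat.Base as ℕ using (ℕ)
open import Data.Integer.Base using (ℤ; +_; _+_; _*_; 1ℤ)
open import Data.Integer.GCD using (gcd)
open import Data.Product.Base using (Σ; _×_; _,_)
open import Relation.Binary.PropositionalEquality using (_≡_)

Q : ℤ → ℤ → ℤ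
Q x y = (+ 8) * (x * x) + (+ 27) * (y * y)

PrimRep : ℕ → ℤ × ℤ → Set
PrimRep n (x , y) = Q x y ≡ + n × gcd x y ≡ 1ℤ

U : ℕ → ℕ → Set
U p m = Σ (ℤ × ℤ) (PrimRep (p ℕ.* m))

-- Each hypothesis j·p = 8x² + 27y² (j = 1, 4, 8) turns, via (A − B)² + 4AB = (A + B)² with
-- AB = 54w², into p² = a² + 216b² with b ≠ 0.  Composing a primitive representation (u, v) of pm
-- with a ± b√−216 and dividing by p gives again an element of U_{p,m}; p divides the result for
-- exactly one choice of sign, and this defines an involution σ of U_{p,m} that commutes with sign
-- changes up to sign.  Since pm is neither 8 nor 27, U_{p,m} is four sign-copies of its positive
-- part U₊, and σ induces an involution of U₊.  If σ preserved |u| at some (u, v), then m would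
-- divide both 16u² and 54v²; as gcd(m, 6) = gcd(u, v) = 1 this forces m = 1.  So for m > 1
-- exactly one point of each orbit {w, σ w} of U₊ has the smaller |u|, U₊ has 2k elements, and
-- |U_{p,m}| = 8k.  For m = 1, p ≡ 11 (mod 24) rules out j = 4 and j = 8, and any two
-- representations of p agree up to signs, so |U_{p,1}| = 4.

module Submission where

open import Axiom.UniquenessOfIdentityProofs using (module Decidable⇒UIP)
open import Data.Bool.Base using (Bool; true; false)
open import Data.Empty using (⊥; ⊥-elim)
open import Data.Fin.Base using (Fin; zero; suc; toℕ; fromℕ<)
import Data.Fin.Properties as Finₚ
open import Data.Integer.Base using (ℤ; +_; -[1+_]; ∣_∣; 0ℤ; 1ℤ)
import Data.Integer.DivMod as ℤ÷
import Data.Integer.Divisibility.Signed as ℤ∣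
open import Data.Integer.GCD using (gcd)
import Data.Integer.Properties as ℤₚ
open import Data.Integer.Tactic.RingSolver using (solve-∀)
open import Data.Nat.Tactic.RingSolver using () renaming (solve-∀ to ℕsolve-∀)
open import Data.Nat.Base as ℕ using (ℕ; zero; suc; s≤s; z≤n)
open import Data.Nat.Coprimality as Coprimality using (Coprime)
import Data.Nat.Divisibility as ℕ∣
import Data.Nat.DivMod as ℕ÷
import Data.Nat.GCD as ℕgcd
import Data.Nat.Properties as ℕₚ
open import Data.Nat.Primality using (Prime; euclidsLemma; prime⇒irreducible; prime⇒nonZero; ¬prime[0]; ¬prime[1])
open import Data.Product.Base using (Σ; ∃; ∃₂; _×_; _,_; proj₁; proj₂)
open import Data.Product.Function.Dependent.Propositional using (Σ-↔)
open import Data.Product.Function.NonDependent.Propositional using (_×-↔_)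
open import Data.Sum.Base using (_⊎_; inj₁; inj₂; [_,_]; reduce)
open import Data.Sum.Function.Propositional using (_⊎-↔_)
open import Defs
open import Function.Base using (_∘_)
open import Function.Bundles using (_↔_; mk↔ₛ′; Inverse)
open import Function.Properties.Inverse using (↔-trans; ↔-sym; ↔-refl)
open import Relation.Binary.Definitions using (tri<; tri≈; tri>)
open import Relation.Binary.PropositionalEquality hiding ([_])
open import Relation.Nullary using (¬_; Dec; yes; no; Irrelevant)
open import Relation.Nullary.Decidable using (_×-dec_)
open import Relation.Unary using (Decidable)

Finite : Set → Set
Finite A = ∃ λ n → A ↔ Fin n

module _ {A : Set} {P : A → Set} (P-irr : ∀ a → Irrelevant (P a)) where

  proj₁-injective : {x y : Σ A P} → proj₁ x ≡ proj₁ y → x ≡ y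
  proj₁-injective {a , _} refl = cong (a ,_) (P-irr a _ _)

  involution⇒↔Bool×Σ : Decidable P → (ι : A → A) → (∀ a → ι (ι a) ≡ a)
    → (∀ a → P a → ¬ P (ι a)) → (∀ a → ¬ P a → P (ι a)) → A ↔ (Bool × Σ A P)
  involution⇒↔Bool×Σ P? ι ιι yes⇒no no⇒yes = mk↔ₛ′ to from to∘from from∘to
    where
    to : A → Bool × Σ A P
    to a with P? a
    ... | yes pa = true , (a , pa)
    ... | no ¬pa = false , (ι a , no⇒yes a ¬pa)
    from : Bool × Σ A P → A
    from (true , a , _) = a
    from (false , a , _) = ι a
    to∘from : ∀ y → to (from y) ≡ y
    to∘from (true , a , pa) with P? a
    ... | yes _ = cong (true ,_) (proj₁-injective refl)
    ... | no ¬pa = ⊥-elim (¬pa pa)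
    to∘from (false , a , pa) with P? (ι a)
    ... | yes pιa = ⊥-elim (yes⇒no a pa pιa)
    ... | no _ = cong (false ,_) (proj₁-injective (ιι a))
    from∘to : ∀ a → from (to a) ≡ a
    from∘to a with P? a
    ... | yes _ = refl
    ... | no _ = ιι a

Bool×-↔-Fin : ∀ {A : Set} {n} → A ↔ Fin n → (Bool × A) ↔ Fin (2 ℕ.* n)
Bool×-↔-Fin A↔Fin = ↔-trans (↔-sym Finₚ.2↔Bool ×-↔ A↔Fin) (↔-sym Finₚ.*↔×)

↔-finite : {A B : Set} → A ↔ B → Finite B → Finite A
↔-finite A↔B (n , B↔Fin) = n , ↔-trans A↔B B↔Fin

⊎-finite : {A B : Set} → Finite A → Finite B → Finite (A ⊎ B)
⊎-finite (m , A↔) (n , B↔) = m ℕ.+ n , ↔-trans (A↔ ⊎-↔ B↔) (↔-sym Finₚ.+↔⊎)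

proposition-finite : {A : Set} → Irrelevant A → Dec A → Finite A
proposition-finite A-irr (yes a) =
  1 , mk↔ₛ′ (λ _ → zero) (λ _ → a) (λ { zero → refl }) (λ a′ → A-irr a a′)
proposition-finite A-irr (no ¬a) =
  0 , mk↔ₛ′ (λ a → ⊥-elim (¬a a)) (λ ()) (λ ()) (λ a → ⊥-elim (¬a a))

Σ-Fin-suc-↔ : ∀ {n} (P : Fin (suc n) → Set) → Σ (Fin (suc n)) P ↔ (P zero ⊎ Σ (Fin n) (P ∘ suc))
Σ-Fin-suc-↔ P = mk↔ₛ′ to from to∘from from∘to
  where
  to : Σ (Fin _) P → P zero ⊎ Σ (Fin _) (P ∘ suc)
  to (zero , p) = inj₁ p
  to (suc i , p) = inj₂ (i , p)
  from : P zero ⊎ Σ (Fin _) (P ∘ suc) → Σ (Fin _) P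
  from (inj₁ p) = zero , p
  from (inj₂ (i , p)) = suc i , p
  to∘from : ∀ y → to (from y) ≡ y
  to∘from (inj₁ _) = refl
  to∘from (inj₂ _) = refl
  from∘to : ∀ x → from (to x) ≡ x
  from∘to (zero , _) = refl
  from∘to (suc _ , _) = refl

Σ-Fin-finite : ∀ n {P : Fin n → Set} → Decidable P → (∀ i → Irrelevant (P i)) → Finite (Σ (Fin n) P)
Σ-Fin-finite zero P? P-irr = 0 , mk↔ₛ′ (λ ()) (λ ()) (λ ()) (λ ())
Σ-Fin-finite (suc n) {P} P? P-irr = ↔-finite (Σ-Fin-suc-↔ P)
  (⊎-finite (proposition-finite (P-irr zero) (P? zero)) (Σ-Fin-finite n (P? ∘ suc) (P-irr ∘ suc)))

Σ-finite : {A : Set} {P : A → Set} → Finite A → Decidable P → (∀ a → Irrelevant (P a))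
  → Finite (Σ A P)
Σ-finite {P = P} (n , A↔Fin) P? P-irr =
  ↔-finite (↔-sym (Σ-↔ (↔-sym A↔Fin) ↔-refl)) (Σ-Fin-finite n (P? ∘ from) (P-irr ∘ from))
  where open Inverse A↔Fin

bounded-ℕ²-finite : ∀ M {P : ℕ × ℕ → Set} → Decidable P → (∀ st → Irrelevant (P st))
  → (∀ {s t} → P (s , t) → s ℕ.< M × t ℕ.< M) → Finite (Σ (ℕ × ℕ) P)
bounded-ℕ²-finite M {P} P? P-irr bounded =
  ↔-finite restrict (Σ-finite (M ℕ.* M , ↔-sym (Finₚ.*↔× {M} {M})) (P? ∘ toℕ²) (P-irr ∘ toℕ²))
  where
  toℕ² : Fin M × Fin M → ℕ × ℕ
  toℕ² (i , j) = toℕ i , toℕ j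
  restrict : Σ (ℕ × ℕ) P ↔ Σ (Fin M × Fin M) (P ∘ toℕ²)
  restrict = mk↔ₛ′ to from to∘from from∘to
    where
    to : Σ (ℕ × ℕ) P → Σ (Fin M × Fin M) (P ∘ toℕ²)
    to ((s , t) , h) with bounded h
    ... | s<M , t<M = (fromℕ< s<M , fromℕ< t<M) ,
      subst₂ (λ x y → P (x , y)) (sym (Finₚ.toℕ-fromℕ< s<M)) (sym (Finₚ.toℕ-fromℕ< t<M)) h
    from : Σ (Fin M × Fin M) (P ∘ toℕ²) → Σ (ℕ × ℕ) P
    from (ij , h) = toℕ² ij , h
    to∘from : ∀ y → to (from y) ≡ y
    to∘from ((i , j) , _) = proj₁-injective (P-irr ∘ toℕ²) (cong₂ _,_ (Finₚ.fromℕ<-toℕ i _) (Finₚ.fromℕ<-toℕ j _))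
    from∘to : ∀ x → from (to x) ≡ x
    from∘to ((s , t) , h) with bounded h
    ... | s<M , t<M = proj₁-injective P-irr (cong₂ _,_ (Finₚ.toℕ-fromℕ< s<M) (Finₚ.toℕ-fromℕ< t<M))

m*m≡n*n⇒m≡n : ∀ m n → m ℕ.* m ≡ n ℕ.* n → m ≡ n
m*m≡n*n⇒m≡n m n eq with ℕₚ.<-cmp m n
... | tri≈ _ m≡n _ = m≡n
... | tri< m<n _ _ = ⊥-elim (ℕₚ.<⇒≢ (ℕₚ.*-mono-< m<n m<n) eq)
... | tri> _ _ m>n = ⊥-elim (ℕₚ.<⇒≢ (ℕₚ.*-mono-< m>n m>n) (sym eq))

coprime-* : ∀ {a b c} → Coprime a b → Coprime a c → Coprime a (b ℕ.* c)
coprime-* {a} {b} a⊥b a⊥c (i∣a , i∣bc) =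
  a⊥c (i∣a , Coprimality.coprime-divisor (λ (j∣i , j∣b) → a⊥b (ℕ∣.∣-trans j∣i i∣a , j∣b)) i∣bc)

coprime-6∧∣16u²∧∣54v²⇒≡1 : ∀ {m u v} → Coprime m 2 → Coprime m 3 → Coprime u v
  → m ℕ∣.∣ 16 ℕ.* (u ℕ.* u) → m ℕ∣.∣ 54 ℕ.* (v ℕ.* v) → m ≡ 1
coprime-6∧∣16u²∧∣54v²⇒≡1 {m} {u} {v} m⊥2 m⊥3 u⊥v m∣16u² m∣54v² = v²⊥u² (m∣v² , m∣u²)
  where
  drop2 : ∀ {n} → m ℕ∣.∣ 2 ℕ.* n → m ℕ∣.∣ n
  drop2 = Coprimality.coprime-divisor m⊥2
  drop3 : ∀ {n} → m ℕ∣.∣ 3 ℕ.* n → m ℕ∣.∣ n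
  drop3 = Coprimality.coprime-divisor m⊥3
  16n≡2⁴n : ∀ n → 16 ℕ.* n ≡ 2 ℕ.* (2 ℕ.* (2 ℕ.* (2 ℕ.* n)))
  16n≡2⁴n = ℕsolve-∀
  54n≡2·3³n : ∀ n → 54 ℕ.* n ≡ 2 ℕ.* (3 ℕ.* (3 ℕ.* (3 ℕ.* n)))
  54n≡2·3³n = ℕsolve-∀
  m∣u² : m ℕ∣.∣ u ℕ.* u
  m∣u² = drop2 (drop2 (drop2 (drop2 (subst (m ℕ∣.∣_) (16n≡2⁴n (u ℕ.* u)) m∣16u²))))
  m∣v² : m ℕ∣.∣ v ℕ.* v
  m∣v² = drop3 (drop3 (drop3 (drop2 (subst (m ℕ∣.∣_) (54n≡2·3³n (v ℕ.* v)) m∣54v²))))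
  v²⊥u² : Coprime (v ℕ.* v) (u ℕ.* u)
  v²⊥u² = coprime-* (Coprimality.sym (coprime-* u⊥v u⊥v)) (Coprimality.sym (coprime-* u⊥v u⊥v))

module _ where
  open import Data.Integer.Base using (_+_; _*_; _-_; -_)
  open import Data.Integer.Divisibility.Signed using () renaming (_∣_ to _∣ℤ_)

  -- E₁ ≡ E₂ follows from hypotheses Lᵢ ≡ Rᵢ once E₁ ≡ E₂ + Σ kᵢ (Lᵢ − Rᵢ) is a ring identity,
  -- which the solver then checks.
  linear-combination₁ : ∀ {L R : ℤ} → L ≡ R → ∀ k {E₁ E₂} → E₁ ≡ E₂ + k * (L - R) → E₁ ≡ E₂
  linear-combination₁ {L} refl k {E₁} {E₂} eq = trans eq (vanish E₂ k L)
    where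
    vanish : ∀ E k L → E + k * (L - L) ≡ E
    vanish = solve-∀

  linear-combination₂ : ∀ {L R L′ R′ : ℤ} → L ≡ R → L′ ≡ R′ → ∀ k k′ {E₁ E₂}
    → E₁ ≡ E₂ + k * (L - R) + k′ * (L′ - R′) → E₁ ≡ E₂
  linear-combination₂ {L} {_} {L′} refl refl k k′ {E₁} {E₂} eq = trans eq (vanish E₂ k L k′ L′)
    where
    vanish : ∀ E k L k′ L′ → E + k * (L - L) + k′ * (L′ - L′) ≡ E
    vanish = solve-∀

  linear-combination₃ : ∀ {L R L′ R′ L″ R″ : ℤ} → L ≡ R → L′ ≡ R′ → L″ ≡ R″ → ∀ k k′ k″ {E₁ E₂}
    → E₁ ≡ E₂ + k * (L - R) + k′ * (L′ - R′) + k″ * (L″ - R″) → E₁ ≡ E₂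
  linear-combination₃ {L} {_} {L′} {_} {L″} refl refl refl k k′ k″ {E₁} {E₂} eq =
    trans eq (vanish E₂ k L k′ L′ k″ L″)
    where
    vanish : ∀ E k L k′ L′ k″ L″ → E + k * (L - L) + k′ * (L′ - L′) + k″ * (L″ - L″) ≡ E
    vanish = solve-∀

  linear-combination₄ : ∀ {L R L′ R′ L″ R″ L‴ R‴ : ℤ} → L ≡ R → L′ ≡ R′ → L″ ≡ R″ → L‴ ≡ R‴
    → ∀ k k′ k″ k‴ {E₁ E₂}
    → E₁ ≡ E₂ + k * (L - R) + k′ * (L′ - R′) + k″ * (L″ - R″) + k‴ * (L‴ - R‴) → E₁ ≡ E₂
  linear-combination₄ {L} {_} {L′} {_} {L″} {_} {L‴} refl refl refl refl k k′ k″ k‴ {E₁} {E₂} eq =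
    trans eq (vanish E₂ k L k′ L′ k″ L″ k‴ L‴)
    where
    vanish : ∀ E k L k′ L′ k″ L″ k‴ L‴
      → E + k * (L - L) + k′ * (L′ - L′) + k″ * (L″ - L″) + k‴ * (L‴ - L‴) ≡ E
    vanish = solve-∀

  i*i≡∣i∣*∣i∣ : ∀ i → i * i ≡ + (∣ i ∣ ℕ.* ∣ i ∣)
  i*i≡∣i∣*∣i∣ (+ n) = sym (ℤₚ.pos-* n n)
  i*i≡∣i∣*∣i∣ -[1+ n ] = refl

  -i*-i≡i*i : ∀ i → (- i) * (- i) ≡ i * i
  -i*-i≡i*i = solve-∀

  ∣i∣≡∣j∣⇒i≡j∨i≡-j : ∀ i j → ∣ i ∣ ≡ ∣ j ∣ → i ≡ j ⊎ i ≡ - j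
  ∣i∣≡∣j∣⇒i≡j∨i≡-j (+ n) (+ .n) refl = inj₁ refl
  ∣i∣≡∣j∣⇒i≡j∨i≡-j (+ .(suc n)) -[1+ n ] refl = inj₂ refl
  ∣i∣≡∣j∣⇒i≡j∨i≡-j -[1+ n ] (+ .(suc n)) refl = inj₂ refl
  ∣i∣≡∣j∣⇒i≡j∨i≡-j -[1+ n ] -[1+ .n ] refl = inj₁ refl

  division : ∀ i d .{{_ : ℕ.NonZero d}} → ∃₂ λ q r → r ℕ.< d × i ≡ + d * q + + r
  division i d = i ℤ÷./ℕ d , i ℤ÷.%ℕ d , ℤ÷.n%ℕd<d i d ,
    trans (ℤ÷.a≡a%ℕn+[a/ℕn]*n i d) (rearrange (+ (i ℤ÷.%ℕ d)) (i ℤ÷./ℕ d) (+ d))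
    where
    rearrange : ∀ r q d → r + q * d ≡ d * q + r
    rearrange = solve-∀

  parity : ∀ i → ∃ λ k → i ≡ + 2 * k ⊎ i ≡ + 2 * k + + 1
  parity i with division i 2
  ... | k , 0 , _ , eq = k , inj₁ (trans eq (ℤₚ.+-identityʳ _))
  ... | k , 1 , _ , eq = k , inj₂ eq
  ... | _ , suc (suc _) , s≤s (s≤s ()) , _

  residue-mod-3 : ∀ i → ∃ λ k → i ≡ + 3 * k ⊎ i ≡ + 3 * k + + 1 ⊎ i ≡ + 3 * k + + 2
  residue-mod-3 i with division i 3
  ... | k , 0 , _ , eq = k , inj₁ (trans eq (ℤₚ.+-identityʳ _))
  ... | k , 1 , _ , eq = k , inj₂ (inj₁ eq)
  ... | k , 2 , _ , eq = k , inj₂ (inj₂ eq)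
  ... | _ , suc (suc (suc _)) , s≤s (s≤s (s≤s ())) , _

  k*i≢r : ∀ k i r → 0 ℕ.< r → r ℕ.< k → + k * i ≢ + r
  k*i≢r k i r 0<r r<k eq with ∣ i ∣ | trans (sym (ℤₚ.abs-* (+ k) i)) (cong ∣_∣ eq)
  ... | zero | k*0≡r = ℕₚ.<⇒≢ 0<r (trans (sym (ℕₚ.*-zeroʳ k)) k*0≡r)
  ... | suc n | k*n≡r = ℕₚ.<⇒≱ r<k (ℕₚ.≤-trans (ℕₚ.m≤m*n k (suc n)) (ℕₚ.≤-reflexive k*n≡r))

  distinct-residues : ∀ k i j r {d} → 0 ℕ.< d → d ℕ.< k → + k * i + + r ≢ + k * j + + (r ℕ.+ d)
  distinct-residues k i j r {d} 0<d d<k eq = k*i≢r k (i - j) d 0<d d<k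
    (linear-combination₁ (trans eq (cong (_+_ (+ k * j)) (ℤₚ.pos-+ r d))) (+ 1) (rearrange (+ k) i j (+ r) (+ d)))
    where
    rearrange : ∀ k i j r d → k * (i - j) ≡ d + + 1 * ((k * i + r) - (k * j + (r + d)))
    rearrange = solve-∀

  odd≢even : ∀ k l → + 2 * k + + 1 ≢ + 2 * l
  odd≢even k l eq = distinct-residues 2 l k 0 (s≤s z≤n) (s≤s (s≤s z≤n)) (trans (ℤₚ.+-identityʳ (+ 2 * l)) (sym eq))

  i≢0⇒j≢0⇒i*j≢0 : ∀ {i j} → i ≢ 0ℤ → j ≢ 0ℤ → i * j ≢ 0ℤ
  i≢0⇒j≢0⇒i*j≢0 {i} i≢0 j≢0 ij≡0 = [ i≢0 , j≢0 ] (ℤₚ.i*j≡0⇒i≡0∨j≡0 i ij≡0)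

  i*j≡0⇒i≢0⇒j≡0 : ∀ {i j} → i * j ≡ 0ℤ → i ≢ 0ℤ → j ≡ 0ℤ
  i*j≡0⇒i≢0⇒j≡0 {i} ij≡0 i≢0 = [ (λ i≡0 → ⊥-elim (i≢0 i≡0)) , (λ j≡0 → j≡0) ] (ℤₚ.i*j≡0⇒i≡0∨j≡0 i ij≡0)

  m*i≡k*j*j⇒m∣k*∣j∣*∣j∣ : ∀ {m} k i j → + m * i ≡ + k * (j * j) → m ℕ∣.∣ k ℕ.* (∣ j ∣ ℕ.* ∣ j ∣)
  m*i≡k*j*j⇒m∣k*∣j∣*∣j∣ {m} k i j eq = subst (m ℕ∣.∣_) ∣k*j*j∣≡
    (ℤ∣.∣⇒∣ᵤ (ℤ∣.divides i (trans (sym eq) (ℤₚ.*-comm (+ m) i))))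
    where
    ∣k*j*j∣≡ : ∣ + k * (j * j) ∣ ≡ k ℕ.* (∣ j ∣ ℕ.* ∣ j ∣)
    ∣k*j*j∣≡ = trans (ℤₚ.abs-* (+ k) (j * j)) (cong (k ℕ.*_) (ℤₚ.abs-* j j))

  module IntegerEuclid {p} (p-prime : Prime p) where

    ∣x*y⇒∣x∨∣y : ∀ x y → + p ∣ℤ x * y → + p ∣ℤ x ⊎ + p ∣ℤ y
    ∣x*y⇒∣x∨∣y x y p∣xy with euclidsLemma ∣ x ∣ ∣ y ∣ p-prime (subst (p ℕ∣.∣_) (ℤₚ.abs-* x y) (ℤ∣.∣⇒∣ᵤ p∣xy))
    ... | inj₁ p∣x = inj₁ (ℤ∣.∣ᵤ⇒∣ p∣x)
    ... | inj₂ p∣y = inj₂ (ℤ∣.∣ᵤ⇒∣ p∣y)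

    ∤x⇒∤y⇒∤x*y : ∀ {x y} → ¬ + p ∣ℤ x → ¬ + p ∣ℤ y → ¬ + p ∣ℤ x * y
    ∤x⇒∤y⇒∤x*y {x} {y} p∤x p∤y p∣xy = [ p∤x , p∤y ] (∣x*y⇒∣x∨∣y x y p∣xy)

    ∤x⇒∣x*y⇒∣y : ∀ {x y} → ¬ + p ∣ℤ x → + p ∣ℤ x * y → + p ∣ℤ y
    ∤x⇒∣x*y⇒∣y {x} {y} p∤x p∣xy = [ (λ p∣x → ⊥-elim (p∤x p∣x)) , (λ p∣y → p∣y) ] (∣x*y⇒∣x∨∣y x y p∣xy)

    ∣x*x⇒∣x : ∀ {x} → + p ∣ℤ x * x → + p ∣ℤ x
    ∣x*x⇒∣x {x} p∣xx = reduce (∣x*y⇒∣x∨∣y x x p∣xx)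

module _ where
  open import Data.Integer.Base using (_+_; _*_; _-_; -_)

  Q≡+⇒ℕ : ∀ {u v C} → Q u v ≡ + C → 8 ℕ.* (∣ u ∣ ℕ.* ∣ u ∣) ℕ.+ 27 ℕ.* (∣ v ∣ ℕ.* ∣ v ∣) ≡ C
  Q≡+⇒ℕ {u} {v} eq = ℤₚ.+-injective (trans cast eq)
    where
    open ≡-Reasoning
    cast : + (8 ℕ.* (∣ u ∣ ℕ.* ∣ u ∣) ℕ.+ 27 ℕ.* (∣ v ∣ ℕ.* ∣ v ∣)) ≡ Q u v
    cast = begin
      + (8 ℕ.* (∣ u ∣ ℕ.* ∣ u ∣) ℕ.+ 27 ℕ.* (∣ v ∣ ℕ.* ∣ v ∣))
        ≡⟨ ℤₚ.pos-+ (8 ℕ.* (∣ u ∣ ℕ.* ∣ u ∣)) _ ⟩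
      + (8 ℕ.* (∣ u ∣ ℕ.* ∣ u ∣)) + + (27 ℕ.* (∣ v ∣ ℕ.* ∣ v ∣))
        ≡⟨ cong₂ _+_ (ℤₚ.pos-* 8 (∣ u ∣ ℕ.* ∣ u ∣)) (ℤₚ.pos-* 27 (∣ v ∣ ℕ.* ∣ v ∣)) ⟩
      + 8 * + (∣ u ∣ ℕ.* ∣ u ∣) + + 27 * + (∣ v ∣ ℕ.* ∣ v ∣)
        ≡⟨ cong₂ (λ s t → + 8 * s + + 27 * t) (sym (i*i≡∣i∣*∣i∣ u)) (sym (i*i≡∣i∣*∣i∣ v)) ⟩
      Q u v ∎

  PrimRep-∣u∣⇒∣v∣ : ∀ {N u v u′ v′} → PrimRep N (u , v) → PrimRep N (u′ , v′) → ∣ u′ ∣ ≡ ∣ u ∣ → ∣ v′ ∣ ≡ ∣ v ∣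
  PrimRep-∣u∣⇒∣v∣ {N} {u} {v} {u′} {v′} (Q≡N , _) (Q′≡N , _) ∣u′∣≡∣u∣ =
    m*m≡n*n⇒m≡n ∣ v′ ∣ ∣ v ∣ (ℕₚ.*-cancelˡ-≡ _ _ 27 (ℕₚ.+-cancelˡ-≡ (8 ℕ.* (∣ u ∣ ℕ.* ∣ u ∣)) _ _ (trans
      (subst (λ n → 8 ℕ.* (n ℕ.* n) ℕ.+ 27 ℕ.* (∣ v′ ∣ ℕ.* ∣ v′ ∣) ≡ N) ∣u′∣≡∣u∣ (Q≡+⇒ℕ {u′} {v′} Q′≡N))
      (sym (Q≡+⇒ℕ {u} {v} Q≡N)))))

  PrimRep-irrelevant : ∀ {N z} → Irrelevant (PrimRep N z)
  PrimRep-irrelevant (q₁ , g₁) (q₂ , g₂) = cong₂ _,_ (≡-irrelevant q₁ q₂) (≡-irrelevant g₁ g₂)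
    where open Decidable⇒UIP ℤₚ._≟_

  PrimRep? : ∀ N → Decidable (PrimRep N)
  PrimRep? N (u , v) = (Q u v ℤₚ.≟ + N) ×-dec (gcd u v ℤₚ.≟ 1ℤ)

  PrimRep-negˡ : ∀ {N u v} → PrimRep N (u , v) → PrimRep N (- u , v)
  PrimRep-negˡ {u = u} {v} (q , g) =
    trans (cong (λ s → + 8 * s + + 27 * (v * v)) (-i*-i≡i*i u)) q ,
    trans (cong (λ n → + ℕgcd.gcd n ∣ v ∣) (ℤₚ.∣-i∣≡∣i∣ u)) g

  PrimRep-negʳ : ∀ {N u v} → PrimRep N (u , v) → PrimRep N (u , - v)
  PrimRep-negʳ {u = u} {v} (q , g) =
    trans (cong (λ t → + 8 * (u * u) + + 27 * t) (-i*-i≡i*i v)) q ,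
    trans (cong (λ n → + ℕgcd.gcd ∣ u ∣ n) (ℤₚ.∣-i∣≡∣i∣ v)) g

  PrimRep[0,v]⇒N≡27 : ∀ {N v} → PrimRep N (0ℤ , v) → N ≡ 27
  PrimRep[0,v]⇒N≡27 {v = v} (q , g)
    with ∣i∣≡∣j∣⇒i≡j∨i≡-j v (+ 1) (trans (sym (ℕgcd.gcd-identityˡ ∣ v ∣)) (ℤₚ.+-injective g))
  ... | inj₁ refl = sym (ℤₚ.+-injective q)
  ... | inj₂ refl = sym (ℤₚ.+-injective q)

  PrimRep[u,0]⇒N≡8 : ∀ {N u} → PrimRep N (u , 0ℤ) → N ≡ 8
  PrimRep[u,0]⇒N≡8 {u = u} (q , g)
    with ∣i∣≡∣j∣⇒i≡j∨i≡-j u (+ 1) (trans (sym (ℕgcd.gcd-identityʳ ∣ u ∣)) (ℤₚ.+-injective g))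
  ... | inj₁ refl = sym (ℤₚ.+-injective q)
  ... | inj₂ refl = sym (ℤₚ.+-injective q)

abs² : ℤ × ℤ → ℤ × ℤ
abs² (u , v) = + ∣ u ∣ , + ∣ v ∣

module Signs (N : ℕ) (N≢8 : N ≢ 8) (N≢27 : N ≢ 27) where

  PositiveRep : ℕ × ℕ → Set
  PositiveRep (s , t) = PrimRep N (+ suc s , + suc t)

  U₊ : Set
  U₊ = Σ (ℕ × ℕ) PositiveRep

  toℤ² : U₊ → ℤ × ℤ
  toℤ² ((s , t) , _) = + suc s , + suc t

  PositiveRep-irrelevant : ∀ st → Irrelevant (PositiveRep st)
  PositiveRep-irrelevant (s , t) = PrimRep-irrelevant {N} {+ suc s , + suc t}

  toℤ²-injective : ∀ {w w′} → toℤ² w ≡ toℤ² w′ → w ≡ w′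
  toℤ²-injective {(s , t) , _} {(s′ , t′) , _} eq = proj₁-injective {P = PositiveRep} PositiveRep-irrelevant
    (cong₂ _,_ (ℕₚ.suc-injective (ℤₚ.+-injective (cong proj₁ eq)))
               (ℕₚ.suc-injective (ℤₚ.+-injective (cong proj₂ eq))))

  ¬PrimRep[0,v] : ∀ v → ¬ PrimRep N (0ℤ , v)
  ¬PrimRep[0,v] v h = N≢27 (PrimRep[0,v]⇒N≡27 {N} {v} h)

  ¬PrimRep[u,0] : ∀ u → ¬ PrimRep N (u , 0ℤ)
  ¬PrimRep[u,0] u h = N≢8 (PrimRep[u,0]⇒N≡8 {N} {u} h)

  positive : ∀ z → PrimRep N z → U₊
  positive (+ zero , v) h = ⊥-elim (¬PrimRep[0,v] v h)
  positive (+ suc s , + zero) h = ⊥-elim (¬PrimRep[u,0] (+ suc s) h)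
  positive (+ suc s , + suc t) h = (s , t) , h
  positive (+ suc s , -[1+ t ]) h = (s , t) , h
  positive (-[1+ s ] , + zero) h = ⊥-elim (¬PrimRep[u,0] -[1+ s ] h)
  positive (-[1+ s ] , + suc t) h = (s , t) , h
  positive (-[1+ s ] , -[1+ t ]) h = (s , t) , h

  toℤ²-positive : ∀ z h → toℤ² (positive z h) ≡ abs² z
  toℤ²-positive (+ zero , v) h = ⊥-elim (¬PrimRep[0,v] v h)
  toℤ²-positive (+ suc s , + zero) h = ⊥-elim (¬PrimRep[u,0] (+ suc s) h)
  toℤ²-positive (+ suc s , + suc t) h = refl
  toℤ²-positive (+ suc s , -[1+ t ]) h = refl
  toℤ²-positive (-[1+ s ] , + zero) h = ⊥-elim (¬PrimRep[u,0] -[1+ s ] h)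
  toℤ²-positive (-[1+ s ] , + suc t) h = refl
  toℤ²-positive (-[1+ s ] , -[1+ t ]) h = refl

  U↔signs×U₊ : Σ (ℤ × ℤ) (PrimRep N) ↔ (Bool × Bool × U₊)
  U↔signs×U₊ = mk↔ₛ′ to from to∘from from∘to
    where
    nonNegative : ℤ → Bool
    nonNegative (+ _) = true
    nonNegative -[1+ _ ] = false
    to : Σ (ℤ × ℤ) (PrimRep N) → Bool × Bool × U₊
    to ((u , v) , h) = nonNegative u , nonNegative v , positive (u , v) h
    from : Bool × Bool × U₊ → Σ (ℤ × ℤ) (PrimRep N)
    from (true , true , (s , t) , h) = (+ suc s , + suc t) , h
    from (true , false , (s , t) , h) = (+ suc s , -[1+ t ]) , h
    from (false , true , (s , t) , h) = (-[1+ s ] , + suc t) , h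
    from (false , false , (s , t) , h) = (-[1+ s ] , -[1+ t ]) , h
    to∘from : ∀ y → to (from y) ≡ y
    to∘from (true , true , _) = refl
    to∘from (true , false , _) = refl
    to∘from (false , true , _) = refl
    to∘from (false , false , _) = refl
    from∘to : ∀ x → from (to x) ≡ x
    from∘to ((+ zero , v) , h) = ⊥-elim (¬PrimRep[0,v] v h)
    from∘to ((+ suc s , + zero) , h) = ⊥-elim (¬PrimRep[u,0] (+ suc s) h)
    from∘to ((+ suc s , + suc t) , h) = refl
    from∘to ((+ suc s , -[1+ t ]) , h) = refl
    from∘to ((-[1+ s ] , + zero) , h) = ⊥-elim (¬PrimRep[u,0] -[1+ s ] h)
    from∘to ((-[1+ s ] , + suc t) , h) = refl
    from∘to ((-[1+ s ] , -[1+ t ]) , h) = refl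

  U₊-finite : Finite U₊
  U₊-finite = bounded-ℕ²-finite N {PositiveRep} (PrimRep? N ∘ toℤ²′) PositiveRep-irrelevant bounded
    where
    toℤ²′ : ℕ × ℕ → ℤ × ℤ
    toℤ²′ (s , t) = + suc s , + suc t
    n<k*n² : ∀ k n → n ℕ.< suc k ℕ.* (suc n ℕ.* suc n)
    n<k*n² k n = ℕₚ.≤-trans (ℕₚ.m≤m*n (suc n) (suc n)) (ℕₚ.m≤n*m _ (suc k))
    bounded : ∀ {s t} → PositiveRep (s , t) → s ℕ.< N × t ℕ.< N
    bounded {s} {t} (q , _) =
      ℕₚ.≤-trans (n<k*n² 7 s) (ℕₚ.≤-trans (ℕₚ.m≤m+n (8 ℕ.* (suc s ℕ.* suc s)) _) (ℕₚ.≤-reflexive N≡)) ,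
      ℕₚ.≤-trans (n<k*n² 26 t) (ℕₚ.≤-trans (ℕₚ.m≤n+m _ (8 ℕ.* (suc s ℕ.* suc s))) (ℕₚ.≤-reflexive N≡))
      where
      N≡ : 8 ℕ.* (suc s ℕ.* suc s) ℕ.+ 27 ℕ.* (suc t ℕ.* suc t) ≡ N
      N≡ = Q≡+⇒ℕ {+ suc s} {+ suc t} q

n%24≡11∧d∣n∧d∣24⇒d∣11 : ∀ {d n} → n ℕ.% 24 ≡ 11 → d ℕ∣.∣ n → d ℕ∣.∣ 24 → d ℕ∣.∣ 11
n%24≡11∧d∣n∧d∣24⇒d∣11 {d} n%24≡11 d∣n d∣24 = subst (d ℕ∣.∣_) n%24≡11 (ℕ∣.%-presˡ-∣ d∣n d∣24)

n%24≡11⇒coprime-2 : ∀ {n} → n ℕ.% 24 ≡ 11 → Coprime n 2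
n%24≡11⇒coprime-2 n%24≡11 {d} (d∣n , d∣2) = ℕ∣.∣1⇒≡1 (ℕ∣.∣m+n∣m⇒∣n {d} {10} {1} d∣11 (ℕ∣.∣n⇒∣m*n 5 d∣2))
  where
  d∣11 : d ℕ∣.∣ 11
  d∣11 = n%24≡11∧d∣n∧d∣24⇒d∣11 n%24≡11 d∣n (ℕ∣.∣-trans d∣2 (ℕ∣.divides 12 refl))

n%24≡11⇒coprime-3 : ∀ {n} → n ℕ.% 24 ≡ 11 → Coprime n 3
n%24≡11⇒coprime-3 n%24≡11 {d} (d∣n , d∣3) = ℕ∣.∣1⇒≡1 (ℕ∣.∣m+n∣m⇒∣n {d} {2} {1} d∣3 d∣2)
  where
  d∣11 : d ℕ∣.∣ 11
  d∣11 = n%24≡11∧d∣n∧d∣24⇒d∣11 n%24≡11 d∣n (ℕ∣.∣-trans d∣3 (ℕ∣.divides 8 refl))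
  d∣2 : d ℕ∣.∣ 2
  d∣2 = ℕ∣.∣m+n∣m⇒∣n {d} {9} {2} d∣11 (ℕ∣.∣n⇒∣m*n 3 d∣3)

module _ where
  open import Data.Integer.Base using (_+_; _*_; _-_; -_)
  open import Data.Integer.Divisibility.Signed using () renaming (_∣_ to _∣ℤ_)

  a²+216b²≡p²⇒p∣b⇒b≡0 : ∀ {p} .{{_ : ℕ.NonZero p}} a b
    → a * a + + 216 * (b * b) ≡ + p * + p → + p ∣ℤ b → b ≡ 0ℤ
  a²+216b²≡p²⇒p∣b⇒b≡0 {p} a b eq p∣b with b ℤₚ.≟ 0ℤ
  ... | yes b≡0 = b≡0
  ... | no b≢0 = ⊥-elim (ℕₚ.<⇒≱ (s≤s (s≤s z≤n)) (ℕₚ.*-cancelʳ-≤ 216 1 (p ℕ.* p) {{ℕₚ.m*n≢0 p p}} 216p²≤p²))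
    where
    p≤∣b∣ : p ℕ.≤ ∣ b ∣
    p≤∣b∣ = ℕ∣.∣⇒≤ {{ℕ.≢-nonZero (b≢0 ∘ ℤₚ.∣i∣≡0⇒i≡0)}} (ℤ∣.∣⇒∣ᵤ p∣b)
    in-ℕ : ∣ a ∣ ℕ.* ∣ a ∣ ℕ.+ 216 ℕ.* (∣ b ∣ ℕ.* ∣ b ∣) ≡ p ℕ.* p
    in-ℕ = ℤₚ.+-injective (begin
      + (∣ a ∣ ℕ.* ∣ a ∣ ℕ.+ 216 ℕ.* (∣ b ∣ ℕ.* ∣ b ∣))
        ≡⟨ ℤₚ.pos-+ (∣ a ∣ ℕ.* ∣ a ∣) _ ⟩
      + (∣ a ∣ ℕ.* ∣ a ∣) + + (216 ℕ.* (∣ b ∣ ℕ.* ∣ b ∣))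
        ≡⟨ cong₂ _+_ (sym (i*i≡∣i∣*∣i∣ a)) (ℤₚ.pos-* 216 (∣ b ∣ ℕ.* ∣ b ∣)) ⟩
      a * a + + 216 * + (∣ b ∣ ℕ.* ∣ b ∣)
        ≡⟨ cong (λ s → a * a + + 216 * s) (i*i≡∣i∣*∣i∣ b) ⟨
      a * a + + 216 * (b * b)
        ≡⟨ eq ⟩
      + p * + p
        ≡⟨ ℤₚ.pos-* p p ⟨
      + (p ℕ.* p) ∎)
      where open ≡-Reasoning
    216p²≤p² : 216 ℕ.* (p ℕ.* p) ℕ.≤ 1 ℕ.* (p ℕ.* p)
    216p²≤p² = begin
      216 ℕ.* (p ℕ.* p)                                  ≤⟨ ℕₚ.*-monoʳ-≤ 216 (ℕₚ.*-mono-≤ p≤∣b∣ p≤∣b∣) ⟩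
      216 ℕ.* (∣ b ∣ ℕ.* ∣ b ∣)                          ≤⟨ ℕₚ.m≤n+m _ (∣ a ∣ ℕ.* ∣ a ∣) ⟩
      ∣ a ∣ ℕ.* ∣ a ∣ ℕ.+ 216 ℕ.* (∣ b ∣ ℕ.* ∣ b ∣)     ≡⟨ in-ℕ ⟩
      p ℕ.* p                                            ≡⟨ ℕₚ.*-identityˡ (p ℕ.* p) ⟨
      1 ℕ.* (p ℕ.* p)                                    ∎
      where open ℕₚ.≤-Reasoning

  SquareRep : ℕ → Set
  SquareRep p = ∃₂ λ a b → a * a + + 216 * (b * b) ≡ + p * + p × b ≢ 0ℤ

  SquareRep-intro : ∀ {p} A B w → A + B ≡ + p → A * B ≡ + 54 * (w * w) → w ≢ 0ℤ → SquareRep p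
  SquareRep-intro A B w A+B≡p AB≡54w² w≢0 =
    A - B , w , trans (linear-combination₁ AB≡54w² (- + 4) (identity A B w)) (cong (λ s → s * s) A+B≡p) , w≢0
    where
    identity : ∀ A B w → (A - B) * (A - B) + + 216 * (w * w)
      ≡ (A + B) * (A + B) + (- + 4) * (A * B - + 54 * (w * w))
    identity = solve-∀

  2X+27y²≡2n⇒y-even : ∀ X y n → + 2 * X + + 27 * (y * y) ≡ + 2 * n → ∃ λ k → y ≡ + 2 * k
  2X+27y²≡2n⇒y-even X y n eq with parity y
  ... | k , inj₁ y≡2k = k , y≡2k
  ... | k , inj₂ refl = ⊥-elim (odd≢even (X + + 54 * (k * k) + + 54 * k + + 13) n (trans (sym (identity X k)) eq))
    where
    identity : ∀ X k → + 2 * X + + 27 * ((+ 2 * k + + 1) * (+ 2 * k + + 1))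
      ≡ + 2 * (X + + 54 * (k * k) + + 54 * k + + 13) + + 1
    identity = solve-∀

  Q≡4n⇒y≡2k : ∀ x y n → Q x y ≡ + 4 * n → ∃ λ k → y ≡ + 2 * k × + 2 * (x * x) + + 27 * (k * k) ≡ n
  Q≡4n⇒y≡2k x y n eq with 2X+27y²≡2n⇒y-even (+ 4 * (x * x)) y (+ 2 * n) (trans (sym (regroup x y)) (trans eq (4n≡2[2n] n)))
    where
    regroup : ∀ x y → + 8 * (x * x) + + 27 * (y * y) ≡ + 2 * (+ 4 * (x * x)) + + 27 * (y * y)
    regroup = solve-∀
    4n≡2[2n] : ∀ n → + 4 * n ≡ + 2 * (+ 2 * n)
    4n≡2[2n] = solve-∀
  ... | k , refl = k , refl , ℤₚ.*-cancelˡ-≡ (+ 4) _ n (trans (sym (expand x k)) eq)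
    where
    expand : ∀ x k → + 8 * (x * x) + + 27 * ((+ 2 * k) * (+ 2 * k)) ≡ + 4 * (+ 2 * (x * x) + + 27 * (k * k))
    expand = solve-∀

  Q≡8n⇒y≡4l : ∀ x y n → Q x y ≡ + 8 * n → ∃ λ l → y ≡ + 4 * l × x * x + + 54 * (l * l) ≡ n
  Q≡8n⇒y≡4l x y n eq with Q≡4n⇒y≡2k x y (+ 2 * n) (trans eq (8n≡4[2n] n))
    where
    8n≡4[2n] : ∀ n → + 8 * n ≡ + 4 * (+ 2 * n)
    8n≡4[2n] = solve-∀
  ... | k , refl , 2x²+27k²≡2n with 2X+27y²≡2n⇒y-even (x * x) k n 2x²+27k²≡2n
  ...   | l , refl = l , 2[2l]≡4l l , ℤₚ.*-cancelˡ-≡ (+ 2) _ n (trans (sym (expand x l)) 2x²+27k²≡2n)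
    where
    2[2l]≡4l : ∀ l → + 2 * (+ 2 * l) ≡ + 4 * l
    2[2l]≡4l = solve-∀
    expand : ∀ x l → + 2 * (x * x) + + 27 * ((+ 2 * l) * (+ 2 * l)) ≡ + 2 * (x * x + + 54 * (l * l))
    expand = solve-∀

module _ {p} (p-prime : Prime p) (p∤2 : ¬ p ℕ∣.∣ 2) (p∤3 : ¬ p ℕ∣.∣ 3) where
  open import Data.Integer.Base using (_+_; _*_; _-_; -_)
  open import Data.Integer.Divisibility.Signed using () renaming (_∣_ to _∣ℤ_)
  open IntegerEuclid p-prime

  p∤m⇒p∤n⇒p∤m*n : ∀ {m n} → ¬ p ℕ∣.∣ m → ¬ p ℕ∣.∣ n → ¬ p ℕ∣.∣ m ℕ.* n
  p∤m⇒p∤n⇒p∤m*n {m} {n} p∤m p∤n = [ p∤m , p∤n ] ∘ euclidsLemma m n p-prime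

  p∤8 : ¬ p ℕ∣.∣ 8
  p∤8 = p∤m⇒p∤n⇒p∤m*n p∤2 (p∤m⇒p∤n⇒p∤m*n p∤2 p∤2)

  p∤27 : ¬ p ℕ∣.∣ 27
  p∤27 = p∤m⇒p∤n⇒p∤m*n p∤3 (p∤m⇒p∤n⇒p∤m*n p∤3 p∤3)

  p∤54 : ¬ p ℕ∣.∣ 54
  p∤54 = p∤m⇒p∤n⇒p∤m*n p∤2 p∤27

  p∤216 : ¬ p ℕ∣.∣ 216
  p∤216 = p∤m⇒p∤n⇒p∤m*n p∤8 p∤27

  PrimRep[j*p]⇒x≢0×y≢0 : ∀ j x y → PrimRep (j ℕ.* p) (x , y) → x ≢ 0ℤ × y ≢ 0ℤ
  PrimRep[j*p]⇒x≢0×y≢0 j x y h =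
    (λ { refl → p∤27 (subst (p ℕ∣.∣_) (PrimRep[0,v]⇒N≡27 {j ℕ.* p} {y} h) (ℕ∣.n∣m*n j)) }) ,
    (λ { refl → p∤8 (subst (p ℕ∣.∣_) (PrimRep[u,0]⇒N≡8 {j ℕ.* p} {x} h) (ℕ∣.n∣m*n j)) })

  PrimRep[p]⇒SquareRep : ∀ x y → PrimRep (1 ℕ.* p) (x , y) → SquareRep p
  PrimRep[p]⇒SquareRep x y h@(Q≡p , _) with PrimRep[j*p]⇒x≢0×y≢0 1 x y h
  ... | x≢0 , y≢0 = SquareRep-intro (+ 8 * (x * x)) (+ 27 * (y * y)) (+ 2 * x * y)
    (trans Q≡p (cong +_ (ℕₚ.*-identityˡ p))) (product x y) (i≢0⇒j≢0⇒i*j≢0 {+ 2 * x} (i≢0⇒j≢0⇒i*j≢0 {+ 2} (λ ()) x≢0) y≢0)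
    where
    product : ∀ x y → + 8 * (x * x) * (+ 27 * (y * y)) ≡ + 54 * ((+ 2 * x * y) * (+ 2 * x * y))
    product = solve-∀

  PrimRep[4p]⇒SquareRep : ∀ x y → PrimRep (4 ℕ.* p) (x , y) → SquareRep p
  PrimRep[4p]⇒SquareRep x y h@(Q≡4p , _) with PrimRep[j*p]⇒x≢0×y≢0 4 x y h | Q≡4n⇒y≡2k x y (+ p) (trans Q≡4p (ℤₚ.pos-* 4 p))
  ... | x≢0 , y≢0 | k , refl , 2x²+27k²≡p = SquareRep-intro (+ 2 * (x * x)) (+ 27 * (k * k)) (x * k)
    2x²+27k²≡p (product x k) (i≢0⇒j≢0⇒i*j≢0 x≢0 (λ { refl → y≢0 refl }))
    where
    product : ∀ x k → + 2 * (x * x) * (+ 27 * (k * k)) ≡ + 54 * ((x * k) * (x * k))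
    product = solve-∀

  PrimRep[8p]⇒SquareRep : ∀ x y → PrimRep (8 ℕ.* p) (x , y) → SquareRep p
  PrimRep[8p]⇒SquareRep x y h@(Q≡8p , _) with PrimRep[j*p]⇒x≢0×y≢0 8 x y h | Q≡8n⇒y≡4l x y (+ p) (trans Q≡8p (ℤₚ.pos-* 8 p))
  ... | x≢0 , y≢0 | l , refl , x²+54l²≡p = SquareRep-intro (x * x) (+ 54 * (l * l)) (x * l)
    x²+54l²≡p (product x l) (i≢0⇒j≢0⇒i*j≢0 x≢0 (λ { refl → y≢0 refl }))
    where
    product : ∀ x l → x * x * (+ 54 * (l * l)) ≡ + 54 * ((x * l) * (x * l))
    product = solve-∀

  PrimRep[j*p]⇒SquareRep : ∀ {j} → j ≡ 1 ⊎ j ≡ 4 ⊎ j ≡ 8 → ∀ x y → PrimRep (j ℕ.* p) (x , y) → SquareRep p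
  PrimRep[j*p]⇒SquareRep (inj₁ refl) = PrimRep[p]⇒SquareRep
  PrimRep[j*p]⇒SquareRep (inj₂ (inj₁ refl)) = PrimRep[4p]⇒SquareRep
  PrimRep[j*p]⇒SquareRep (inj₂ (inj₂ refl)) = PrimRep[8p]⇒SquareRep

  instance
    p≢0 : ℕ.NonZero p
    p≢0 = prime⇒nonZero p-prime

  +p≢0 : + p ≢ 0ℤ
  +p≢0 p≡0 = ¬prime[0] (subst Prime (ℤₚ.+-injective p≡0) p-prime)

  ∤⇒∤ℤ : ∀ {n} → ¬ p ℕ∣.∣ n → ¬ + p ∣ℤ + n
  ∤⇒∤ℤ p∤n = p∤n ∘ ℤ∣.∣⇒∣ᵤ

  p∣p*i : ∀ i → + p ∣ℤ + p * i
  p∣p*i i = ℤ∣.∣m⇒∣m*n i ℤ∣.∣-refl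

  infix 4 _≡±_
  _≡±_ : ℤ → ℤ → Set
  c ≡± b = c ≡ b ⊎ c ≡ - b

  p*m≢8 : ∀ m → p ℕ.* m ≢ 8
  p*m≢8 m pm≡8 = p∤8 (subst (p ℕ∣.∣_) pm≡8 (ℕ∣.m∣m*n m))

  p*m≢27 : ∀ m → p ℕ.* m ≢ 27
  p*m≢27 m pm≡27 = p∤27 (subst (p ℕ∣.∣_) pm≡27 (ℕ∣.m∣m*n m))

  PrimRep[p]⇒∣u∣∣y∣≡∣v∣∣x∣ : ∀ {x y u v} → PrimRep p (x , y) → PrimRep p (u , v) → ∣ u ∣ ℕ.* ∣ y ∣ ≡ ∣ v ∣ ℕ.* ∣ x ∣
  PrimRep[p]⇒∣u∣∣y∣≡∣v∣∣x∣ {x} {y} {u} {v} (Q[x,y]≡p , _) (Q[u,v]≡p , _) =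
    [ uy≡vx⇒ , uy≡-vx⇒ ] (∣x*y⇒∣x∨∣y (u * y - v * x) (u * y + v * x) (∤x⇒∣x*y⇒∣y (∤⇒∤ℤ p∤216) p∣216[uy-vx][uy+vx]))
    where
    difference : ∀ u v x y p → + 216 * ((u * y - v * x) * (u * y + v * x))
      ≡ (+ 27 * p) * (y * y - v * v) + (+ 27 * (y * y)) * ((+ 8 * (u * u) + + 27 * (v * v)) - p)
        + (- (+ 27 * (v * v))) * ((+ 8 * (x * x) + + 27 * (y * y)) - p)
    difference = solve-∀
    p∣216[uy-vx][uy+vx] : + p ∣ℤ + 216 * ((u * y - v * x) * (u * y + v * x))
    p∣216[uy-vx][uy+vx] = subst (+ p ∣ℤ_)
      (sym (linear-combination₂ Q[u,v]≡p Q[x,y]≡p (+ 27 * (y * y)) (- (+ 27 * (v * v))) (difference u v x y (+ p))))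
      (ℤ∣.∣m⇒∣m*n (y * y - v * v) (ℤ∣.∣n⇒∣m*n (+ 27) ℤ∣.∣-refl))
    product₋ : ∀ u v x y p → (+ 8 * u * x + + 27 * v * y) * (+ 8 * u * x + + 27 * v * y) + + 216 * ((u * y - v * x) * (u * y - v * x))
      ≡ p * p + (+ 8 * (u * u) + + 27 * (v * v)) * ((+ 8 * (x * x) + + 27 * (y * y)) - p) + p * ((+ 8 * (u * u) + + 27 * (v * v)) - p)
    product₋ = solve-∀
    product₊ : ∀ u v x y p → (+ 8 * u * x - + 27 * v * y) * (+ 8 * u * x - + 27 * v * y) + + 216 * ((u * y + v * x) * (u * y + v * x))
      ≡ p * p + (+ 8 * (u * u) + + 27 * (v * v)) * ((+ 8 * (x * x) + + 27 * (y * y)) - p) + p * ((+ 8 * (u * u) + + 27 * (v * v)) - p)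
    product₊ = solve-∀
    uy≡vx⇒ : + p ∣ℤ u * y - v * x → ∣ u ∣ ℕ.* ∣ y ∣ ≡ ∣ v ∣ ℕ.* ∣ x ∣
    uy≡vx⇒ p∣uy-vx = trans (sym (ℤₚ.abs-* u y)) (trans (cong ∣_∣ uy≡vx) (ℤₚ.abs-* v x))
      where
      uy-vx≡0 : u * y - v * x ≡ 0ℤ
      uy-vx≡0 = a²+216b²≡p²⇒p∣b⇒b≡0 (+ 8 * u * x + + 27 * v * y) (u * y - v * x)
        (linear-combination₂ Q[x,y]≡p Q[u,v]≡p (Q u v) (+ p) (product₋ u v x y (+ p))) p∣uy-vx
      uy≡vx : u * y ≡ v * x
      uy≡vx = linear-combination₁ uy-vx≡0 (+ 1) (rearrange (u * y) (v * x))
        where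
        rearrange : ∀ i j → i ≡ j + + 1 * ((i - j) - 0ℤ)
        rearrange = solve-∀
    uy≡-vx⇒ : + p ∣ℤ u * y + v * x → ∣ u ∣ ℕ.* ∣ y ∣ ≡ ∣ v ∣ ℕ.* ∣ x ∣
    uy≡-vx⇒ p∣uy+vx = trans (sym (ℤₚ.abs-* u y)) (trans (cong ∣_∣ uy≡-vx) (trans (ℤₚ.∣-i∣≡∣i∣ (v * x)) (ℤₚ.abs-* v x)))
      where
      uy+vx≡0 : u * y + v * x ≡ 0ℤ
      uy+vx≡0 = a²+216b²≡p²⇒p∣b⇒b≡0 (+ 8 * u * x - + 27 * v * y) (u * y + v * x)
        (linear-combination₂ Q[x,y]≡p Q[u,v]≡p (Q u v) (+ p) (product₊ u v x y (+ p))) p∣uy+vx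
      uy≡-vx : u * y ≡ - (v * x)
      uy≡-vx = linear-combination₁ uy+vx≡0 (+ 1) (rearrange (u * y) (v * x))
        where
        rearrange : ∀ i j → i ≡ - j + + 1 * ((i + j) - 0ℤ)
        rearrange = solve-∀

  PrimRep[p]-unique : ∀ {x y u v} → PrimRep p (x , y) → PrimRep p (u , v) → ∣ u ∣ ≡ ∣ x ∣ × ∣ v ∣ ≡ ∣ y ∣
  PrimRep[p]-unique {x} {y} {u} {v} hxy huv = ℕ∣.∣-antisym u∣x x∣u , ℕ∣.∣-antisym v∣y y∣v
    where
    uy≡vx : ∣ u ∣ ℕ.* ∣ y ∣ ≡ ∣ v ∣ ℕ.* ∣ x ∣
    uy≡vx = PrimRep[p]⇒∣u∣∣y∣≡∣v∣∣x∣ {x} {y} {u} {v} hxy huv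
    u⊥v : Coprime ∣ u ∣ ∣ v ∣
    u⊥v = Coprimality.gcd≡1⇒coprime (ℤₚ.+-injective (proj₂ huv))
    x⊥y : Coprime ∣ x ∣ ∣ y ∣
    x⊥y = Coprimality.gcd≡1⇒coprime (ℤₚ.+-injective (proj₂ hxy))
    u∣x : ∣ u ∣ ℕ∣.∣ ∣ x ∣
    u∣x = Coprimality.coprime-divisor u⊥v (subst (∣ u ∣ ℕ∣.∣_) uy≡vx (ℕ∣.m∣m*n ∣ y ∣))
    x∣u : ∣ x ∣ ℕ∣.∣ ∣ u ∣
    x∣u = Coprimality.coprime-divisor x⊥y (subst (∣ x ∣ ℕ∣.∣_) (trans (sym uy≡vx) (ℕₚ.*-comm ∣ u ∣ ∣ y ∣)) (ℕ∣.n∣m*n ∣ v ∣))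
    v∣y : ∣ v ∣ ℕ∣.∣ ∣ y ∣
    v∣y = Coprimality.coprime-divisor (Coprimality.sym u⊥v) (subst (∣ v ∣ ℕ∣.∣_) (sym uy≡vx) (ℕ∣.m∣m*n ∣ x ∣))
    y∣v : ∣ y ∣ ℕ∣.∣ ∣ v ∣
    y∣v = Coprimality.coprime-divisor (Coprimality.sym x⊥y) (subst (∣ y ∣ ℕ∣.∣_) (trans uy≡vx (ℕₚ.*-comm ∣ v ∣ ∣ x ∣)) (ℕ∣.n∣m*n ∣ u ∣))

  PrimRep[p]⇒U[p,1]↔Fin4 : ∀ {x y} → PrimRep (1 ℕ.* p) (x , y) → U p 1 ↔ Fin 4
  PrimRep[p]⇒U[p,1]↔Fin4 {x} {y} h = ↔-trans U↔signs×U₊ (Bool×-↔-Fin (Bool×-↔-Fin U₊↔Fin1))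
    where
    open Signs (p ℕ.* 1) (p*m≢8 1) (p*m≢27 1)
    h′ : PrimRep (p ℕ.* 1) (x , y)
    h′ = subst (λ n → PrimRep n (x , y)) (trans (ℕₚ.*-identityˡ p) (sym (ℕₚ.*-identityʳ p))) h
    PrimRep[p] : ∀ {u v} → PrimRep (p ℕ.* 1) (u , v) → PrimRep p (u , v)
    PrimRep[p] {u} {v} = subst (λ n → PrimRep n (u , v)) (ℕₚ.*-identityʳ p)
    w₀ : U₊
    w₀ = positive (x , y) h′
    w≡w₀ : ∀ w → w ≡ w₀
    w≡w₀ ((s , t) , hw) = toℤ²-injective (trans (cong₂ (λ i j → + i , + j) (proj₁ same) (proj₂ same))
      (sym (toℤ²-positive (x , y) h′)))
      where
      same : suc s ≡ ∣ x ∣ × suc t ≡ ∣ y ∣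
      same = PrimRep[p]-unique {x} {y} {+ suc s} {+ suc t} (PrimRep[p] {x} {y} h′) (PrimRep[p] {+ suc s} {+ suc t} hw)
    U₊↔Fin1 : U₊ ↔ Fin 1
    U₊↔Fin1 = mk↔ₛ′ (λ _ → zero) (λ _ → w₀) (λ { zero → refl }) (λ w → sym (w≡w₀ w))

  module _ (p%24≡11 : p ℕ.% 24 ≡ 11) where

    q : ℤ
    q = + (p ℕ./ 24)

    p≡24q+11 : + p ≡ + 24 * q + + 11
    p≡24q+11 = begin
      + p                                  ≡⟨ cong +_ (ℕ÷.m≡m%n+[m/n]*n p 24) ⟩
      + (p ℕ.% 24 ℕ.+ p ℕ./ 24 ℕ.* 24)     ≡⟨ cong (λ r → + (r ℕ.+ p ℕ./ 24 ℕ.* 24)) p%24≡11 ⟩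
      + (11 ℕ.+ p ℕ./ 24 ℕ.* 24)           ≡⟨ ℤₚ.pos-+ 11 (p ℕ./ 24 ℕ.* 24) ⟩
      + 11 + + (p ℕ./ 24 ℕ.* 24)           ≡⟨ cong (_+_ (+ 11)) (ℤₚ.pos-* (p ℕ./ 24) 24) ⟩
      + 11 + q * + 24                      ≡⟨ rearrange q ⟩
      + 24 * q + + 11                      ∎
      where
      open ≡-Reasoning
      rearrange : ∀ q → + 11 + q * + 24 ≡ + 24 * q + + 11
      rearrange = solve-∀

    p≡2[12q+5]+1 : + p ≡ + 2 * (+ 12 * q + + 5) + + 1
    p≡2[12q+5]+1 = trans p≡24q+11 (regroup q)
      where
      regroup : ∀ q → + 24 * q + + 11 ≡ + 2 * (+ 12 * q + + 5) + + 1
      regroup = solve-∀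

    p≡4[6q+2]+3 : + p ≡ + 4 * (+ 6 * q + + 2) + + 3
    p≡4[6q+2]+3 = trans p≡24q+11 (regroup q)
      where
      regroup : ∀ q → + 24 * q + + 11 ≡ + 4 * (+ 6 * q + + 2) + + 3
      regroup = solve-∀

    p≡3[8q+3]+2 : + p ≡ + 3 * (+ 8 * q + + 3) + + 2
    p≡3[8q+3]+2 = trans p≡24q+11 (regroup q)
      where
      regroup : ∀ q → + 24 * q + + 11 ≡ + 3 * (+ 8 * q + + 3) + + 2
      regroup = solve-∀

    ¬PrimRep[4p] : ∀ x y → ¬ PrimRep (4 ℕ.* p) (x , y)
    ¬PrimRep[4p] x y h@(Q≡4p , gcd≡1) with Q≡4n⇒y≡2k x y (+ p) (trans Q≡4p (ℤₚ.pos-* 4 p)) | parity x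
    ... | k , refl , _ | s , inj₁ refl = 2∤1 (ℕ∣.∣1⇒≡1 (subst (2 ℕ∣.∣_) (ℤₚ.+-injective gcd≡1)
          (ℕgcd.gcd-greatest (ℤ∣.∣⇒∣ᵤ (2∣2* s)) (ℤ∣.∣⇒∣ᵤ (2∣2* k)))))
      where
      2∤1 : 2 ≢ 1
      2∤1 ()
      2∣2* : ∀ i → + 2 ∣ℤ + 2 * i
      2∣2* i = ℤ∣.∣m⇒∣m*n i ℤ∣.∣-refl
    ... | k , refl , 2x²+27k²≡p | s , inj₂ refl with parity k
    ...   | t , inj₁ refl = odd≢even (+ 12 * q + + 5) (x * x + + 54 * (t * t))
            (trans (sym p≡2[12q+5]+1) (trans (sym 2x²+27k²≡p) (even x t)))
      where
      even : ∀ x t → + 2 * (x * x) + + 27 * ((+ 2 * t) * (+ 2 * t)) ≡ + 2 * (x * x + + 54 * (t * t))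
      even = solve-∀
    ...   | t , inj₂ refl = distinct-residues 4 (+ 2 * (s * s) + + 2 * s + + 27 * (t * t) + + 27 * t + + 7) (+ 6 * q + + 2) 1
            (s≤s z≤n) (s≤s (s≤s (s≤s z≤n)))
            (trans (sym (residue-1 s t)) (trans 2x²+27k²≡p p≡4[6q+2]+3))
      where
      residue-1 : ∀ s t → + 2 * ((+ 2 * s + + 1) * (+ 2 * s + + 1)) + + 27 * ((+ 2 * t + + 1) * (+ 2 * t + + 1))
        ≡ + 4 * (+ 2 * (s * s) + + 2 * s + + 27 * (t * t) + + 27 * t + + 7) + + 1
      residue-1 = solve-∀

    ¬PrimRep[8p] : ∀ x y → ¬ PrimRep (8 ℕ.* p) (x , y)
    ¬PrimRep[8p] x y (Q≡8p , _) with Q≡8n⇒y≡4l x y (+ p) (trans Q≡8p (ℤₚ.pos-* 8 p)) | residue-mod-3 x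
    ... | l , _ , x²+54l²≡p | s , inj₁ refl = distinct-residues 3 (+ 3 * (s * s) + + 18 * (l * l)) (+ 8 * q + + 3) 0
          (s≤s z≤n) (s≤s (s≤s (s≤s z≤n))) (trans (sym (residue-0 s l)) (trans x²+54l²≡p p≡3[8q+3]+2))
      where
      residue-0 : ∀ s l → (+ 3 * s) * (+ 3 * s) + + 54 * (l * l) ≡ + 3 * (+ 3 * (s * s) + + 18 * (l * l)) + + 0
      residue-0 = solve-∀
    ... | l , _ , x²+54l²≡p | s , inj₂ (inj₁ refl) = distinct-residues 3 (+ 3 * (s * s) + + 2 * s + + 18 * (l * l)) (+ 8 * q + + 3) 1
          (s≤s z≤n) (s≤s (s≤s z≤n)) (trans (sym (residue-1 s l)) (trans x²+54l²≡p p≡3[8q+3]+2))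
      where
      residue-1 : ∀ s l → (+ 3 * s + + 1) * (+ 3 * s + + 1) + + 54 * (l * l) ≡ + 3 * (+ 3 * (s * s) + + 2 * s + + 18 * (l * l)) + + 1
      residue-1 = solve-∀
    ... | l , _ , x²+54l²≡p | s , inj₂ (inj₂ refl) = distinct-residues 3 (+ 3 * (s * s) + + 4 * s + + 1 + + 18 * (l * l)) (+ 8 * q + + 3) 1
          (s≤s z≤n) (s≤s (s≤s z≤n)) (trans (sym (residue-1 s l)) (trans x²+54l²≡p p≡3[8q+3]+2))
      where
      residue-1 : ∀ s l → (+ 3 * s + + 2) * (+ 3 * s + + 2) + + 54 * (l * l) ≡ + 3 * (+ 3 * (s * s) + + 4 * s + + 1 + + 18 * (l * l)) + + 1
      residue-1 = solve-∀

    PrimRep[j*p]⇒U[p,1]↔Fin4 : ∀ {j} → j ≡ 1 ⊎ j ≡ 4 ⊎ j ≡ 8 → ∀ x y → PrimRep (j ℕ.* p) (x , y) → U p 1 ↔ Fin 4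
    PrimRep[j*p]⇒U[p,1]↔Fin4 (inj₁ refl) x y = PrimRep[p]⇒U[p,1]↔Fin4 {x} {y}
    PrimRep[j*p]⇒U[p,1]↔Fin4 (inj₂ (inj₁ refl)) x y h = ⊥-elim (¬PrimRep[4p] x y h)
    PrimRep[j*p]⇒U[p,1]↔Fin4 (inj₂ (inj₂ refl)) x y h = ⊥-elim (¬PrimRep[8p] x y h)

  module Involution {m} (p∤m : ¬ p ℕ∣.∣ m) (rep : SquareRep p) where

    a : ℤ
    a = proj₁ rep

    b : ℤ
    b = proj₁ (proj₂ rep)

    a²+216b²≡p² : a * a + + 216 * (b * b) ≡ + p * + p
    a²+216b²≡p² = proj₁ (proj₂ (proj₂ rep))

    b≢0 : b ≢ 0ℤ
    b≢0 = proj₂ (proj₂ (proj₂ rep))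

    InU : ℤ × ℤ → Set
    InU = PrimRep (p ℕ.* m)

    Q≡p*m : ∀ {u v} → InU (u , v) → Q u v ≡ + p * + m
    Q≡p*m (Q≡ , _) = trans Q≡ (ℤₚ.pos-* p m)

    p∤b : ¬ + p ∣ℤ b
    p∤b p∣b = b≢0 (a²+216b²≡p²⇒p∣b⇒b≡0 a b a²+216b²≡p² p∣b)

    ±b-square : ∀ {c} → c ≡± b → a * a + + 216 * (c * c) ≡ + p * + p
    ±b-square (inj₁ refl) = a²+216b²≡p²
    ±b-square (inj₂ refl) = trans (cong (λ s → a * a + + 216 * s) (-i*-i≡i*i b)) a²+216b²≡p²

    p∤±b : ∀ {c} → c ≡± b → ¬ + p ∣ℤ c
    p∤±b (inj₁ refl) = p∤b
    p∤±b (inj₂ refl) p∣-b = p∤b (subst (+ p ∣ℤ_) (ℤₚ.neg-involutive b) (ℤ∣.∣m⇒∣-m p∣-b))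

    ±b-neg : ∀ {c} → c ≡± b → - c ≡± b
    ±b-neg (inj₁ refl) = inj₂ refl
    ±b-neg (inj₂ refl) = inj₁ (ℤₚ.neg-involutive b)

    -- 8X² + 27Y² = (8u² + 27v²)(a² + 216c²) = p²·pm, so (X/p, Y/p) is again a representation of pm.
    X : ℤ → ℤ → ℤ → ℤ
    X c u v = a * u + + 27 * c * v

    Y : ℤ → ℤ → ℤ → ℤ
    Y c u v = + 8 * c * u - a * v

    ¬[p∣u×p∣v] : ∀ {u v} → InU (u , v) → + p ∣ℤ u → + p ∣ℤ v → ⊥
    ¬[p∣u×p∣v] (_ , gcd≡1) p∣u p∣v = ¬prime[1] (subst Prime (ℕ∣.∣1⇒≡1 p∣1) p-prime)
      where
      p∣1 : p ℕ∣.∣ 1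
      p∣1 = subst (p ℕ∣.∣_) (ℤₚ.+-injective gcd≡1) (ℕgcd.gcd-greatest (ℤ∣.∣⇒∣ᵤ p∣u) (ℤ∣.∣⇒∣ᵤ p∣v))

    p∣X[b]⊎p∣X[-b] : ∀ {u v} → InU (u , v) → + p ∣ℤ X b u v ⊎ + p ∣ℤ X (- b) u v
    p∣X[b]⊎p∣X[-b] {u} {v} h = ∣x*y⇒∣x∨∣y (X b u v) (X (- b) u v)
      (subst (+ p ∣ℤ_) (sym (linear-combination₂ a²+216b²≡p² (Q≡p*m {u} {v} h) (u * u) (- (+ 27 * (b * b)))
        (identity a b u v (+ p) (+ m)))) (p∣p*i _))
      where
      identity : ∀ a b u v p m → (a * u + + 27 * b * v) * (a * u + + 27 * (- b) * v)
        ≡ p * (p * (u * u) - + 27 * (b * b) * m) + (u * u) * ((a * a + + 216 * (b * b)) - p * p)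
          + (- (+ 27 * (b * b))) * ((+ 8 * (u * u) + + 27 * (v * v)) - p * m)
      identity = solve-∀

    ¬[p∣X[b]×p∣X[-b]] : ∀ {u v} → InU (u , v) → + p ∣ℤ X b u v → + p ∣ℤ X (- b) u v → ⊥
    ¬[p∣X[b]×p∣X[-b]] {u} {v} h p∣X₊ p∣X₋ = ¬[p∣u×p∣v] {u} {v} h p∣u p∣v
      where
      difference : ∀ a b u v → (a * u + + 27 * b * v) - (a * u + + 27 * (- b) * v) ≡ + 54 * b * v
      difference = solve-∀
      p∣v : + p ∣ℤ v
      p∣v = ∤x⇒∣x*y⇒∣y (∤x⇒∤y⇒∤x*y (∤⇒∤ℤ p∤54) p∤b)
        (subst (+ p ∣ℤ_) (difference a b u v) (ℤ∣.∣m∣n⇒∣m-n p∣X₊ p∣X₋))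
      p∣8u² : + p ∣ℤ + 8 * (u * u)
      p∣8u² = ℤ∣.∣m+n∣n⇒∣m (subst (+ p ∣ℤ_) (sym (Q≡p*m {u} {v} h)) (p∣p*i (+ m)))
        (ℤ∣.∣n⇒∣m*n (+ 27) (ℤ∣.∣m⇒∣m*n v p∣v))
      p∣u : + p ∣ℤ u
      p∣u = ∣x*x⇒∣x (∤x⇒∣x*y⇒∣y (∤⇒∤ℤ p∤8) p∣8u²)

    p∣X⇒p∣Y : ∀ {c u v} → c ≡± b → + p ∣ℤ X c u v → + p ∣ℤ Y c u v
    p∣X⇒p∣Y {c} {u} {v} c≡±b p∣X = ∤x⇒∣x*y⇒∣y (∤x⇒∤y⇒∤x*y (∤⇒∤ℤ p∤27) (p∤±b c≡±b))
      (subst (+ p ∣ℤ_) (sym (linear-combination₁ (±b-square c≡±b) u (identity a c u v (+ p))))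
        (ℤ∣.∣m∣n⇒∣m-n (p∣p*i _) (ℤ∣.∣n⇒∣m*n a p∣X)))
      where
      identity : ∀ a c u v p → (+ 27 * c) * (+ 8 * c * u - a * v)
        ≡ (p * (p * u) - a * (a * u + + 27 * c * v)) + u * ((a * a + + 216 * (c * c)) - p * p)
      identity = solve-∀

    -- The value 0 off the multiples of p is junk: quot is only ever applied to multiples.
    quotient-if : ∀ {z} → Dec (+ p ∣ℤ z) → ℤ
    quotient-if (yes p∣z) = ℤ∣.quotient p∣z
    quotient-if (no _) = 0ℤ

    quot : ℤ → ℤ
    quot z = quotient-if (+ p ℤ∣.∣? z)

    quot*p≡ : ∀ {z} → + p ∣ℤ z → quot z * + p ≡ z
    quot*p≡ {z} p∣z = lemma (+ p ℤ∣.∣? z)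
      where
      lemma : (p∣?z : Dec (+ p ∣ℤ z)) → quotient-if p∣?z * + p ≡ z
      lemma (yes p∣z′) = sym (ℤ∣._∣_.equality p∣z′)
      lemma (no p∤z) = ⊥-elim (p∤z p∣z)

    quot-unique : ∀ {z w} → z ≡ w * + p → quot z ≡ w
    quot-unique {z} {w} z≡wp = ℤₚ.*-cancelʳ-≡ (quot z) w (+ p) (trans (quot*p≡ (ℤ∣.divides w z≡wp)) z≡wp)

    ∣quot∣-cong : ∀ {z z′} → + p ∣ℤ z → + p ∣ℤ z′ → ∣ z ∣ ≡ ∣ z′ ∣ → ∣ quot z ∣ ≡ ∣ quot z′ ∣
    ∣quot∣-cong {z} {z′} p∣z p∣z′ ∣z∣≡∣z′∣ = ℕₚ.*-cancelʳ-≡ ∣ quot z ∣ ∣ quot z′ ∣ p (begin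
      ∣ quot z ∣ ℕ.* p     ≡⟨ ℤₚ.abs-* (quot z) (+ p) ⟨
      ∣ quot z * + p ∣     ≡⟨ cong ∣_∣ (quot*p≡ p∣z) ⟩
      ∣ z ∣                ≡⟨ ∣z∣≡∣z′∣ ⟩
      ∣ z′ ∣               ≡⟨ cong ∣_∣ (quot*p≡ p∣z′) ⟨
      ∣ quot z′ * + p ∣    ≡⟨ ℤₚ.abs-* (quot z′) (+ p) ⟩
      ∣ quot z′ ∣ ℕ.* p    ∎)
      where open ≡-Reasoning

    σ[_] : ℤ → ℤ × ℤ → ℤ × ℤ
    σ[ c ] (u , v) = quot (X c u v) , quot (Y c u v)

    σ-if : ∀ u v → Dec (+ p ∣ℤ X b u v) → ℤ × ℤ
    σ-if u v (yes _) = σ[ b ] (u , v)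
    σ-if u v (no _) = σ[ - b ] (u , v)

    σ : ℤ × ℤ → ℤ × ℤ
    σ (u , v) = σ-if u v (+ p ℤ∣.∣? X b u v)

    σ≡σ[c] : ∀ {c u v} → c ≡± b → InU (u , v) → + p ∣ℤ X c u v → σ (u , v) ≡ σ[ c ] (u , v)
    σ≡σ[c] {c} {u} {v} c≡±b h p∣X = lemma c≡±b (+ p ℤ∣.∣? X b u v)
      where
      lemma : c ≡± b → (p∣?X : Dec (+ p ∣ℤ X b u v)) → σ-if u v p∣?X ≡ σ[ c ] (u , v)
      lemma (inj₁ refl) (yes _) = refl
      lemma (inj₁ refl) (no p∤X) = ⊥-elim (p∤X p∣X)
      lemma (inj₂ refl) (yes p∣X₊) = ⊥-elim (¬[p∣X[b]×p∣X[-b]] {u} {v} h p∣X₊ p∣X)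
      lemma (inj₂ refl) (no _) = refl

    Admissible : ℤ → ℤ → ℤ → Set
    Admissible u v c = c ≡± b × + p ∣ℤ X c u v

    admissible : ∀ {u v} → InU (u , v) → ∃ (Admissible u v)
    admissible {u} {v} h =
      [ (λ p∣X₊ → b , inj₁ refl , p∣X₊) , (λ p∣X₋ → - b , inj₂ refl , p∣X₋) ] (p∣X[b]⊎p∣X[-b] {u} {v} h)

    Q≡pm⇒¬[p∣x×p∣y] : ∀ {x y} → Q x y ≡ + p * + m → + p ∣ℤ x → + p ∣ℤ y → ⊥
    Q≡pm⇒¬[p∣x×p∣y] Q≡pm (ℤ∣.divides s refl) (ℤ∣.divides t refl) = p∤m (ℤ∣.∣⇒∣ᵤ p∣m)
      where
      scale : ∀ s t p → + 8 * ((s * p) * (s * p)) + + 27 * ((t * p) * (t * p))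
        ≡ p * (p * (+ 8 * (s * s) + + 27 * (t * t)))
      scale = solve-∀
      m≡p*Q : + m ≡ + p * Q s t
      m≡p*Q = ℤₚ.*-cancelˡ-≡ (+ p) (+ m) (+ p * Q s t) (trans (sym Q≡pm) (scale s t (+ p)))
      p∣m : + p ∣ℤ + m
      p∣m = subst (+ p ∣ℤ_) (sym m≡p*Q) (p∣p*i _)

    module Image {c u v} (c≡±b : c ≡± b) (h : InU (u , v)) (p∣X : + p ∣ℤ X c u v) where

      u′ : ℤ
      u′ = quot (X c u v)

      v′ : ℤ
      v′ = quot (Y c u v)

      u′*p≡X : u′ * + p ≡ X c u v
      u′*p≡X = quot*p≡ p∣X

      v′*p≡Y : v′ * + p ≡ Y c u v
      v′*p≡Y = quot*p≡ (p∣X⇒p∣Y c≡±b p∣X)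

      X[u′,v′]≡p*u : X c u′ v′ ≡ + p * u
      X[u′,v′]≡p*u = ℤₚ.*-cancelʳ-≡ (X c u′ v′) (+ p * u) (+ p)
        (linear-combination₃ u′*p≡X v′*p≡Y (±b-square c≡±b) a (+ 27 * c) u (identity a c u v u′ v′ (+ p)))
        where
        identity : ∀ a c u v u′ v′ p → (a * u′ + + 27 * c * v′) * p
          ≡ (p * u) * p + a * (u′ * p - (a * u + + 27 * c * v)) + (+ 27 * c) * (v′ * p - (+ 8 * c * u - a * v))
            + u * ((a * a + + 216 * (c * c)) - p * p)
        identity = solve-∀

      Y[u′,v′]≡p*v : Y c u′ v′ ≡ + p * v
      Y[u′,v′]≡p*v = ℤₚ.*-cancelʳ-≡ (Y c u′ v′) (+ p * v) (+ p)
        (linear-combination₃ u′*p≡X v′*p≡Y (±b-square c≡±b) (+ 8 * c) (- a) v (identity a c u v u′ v′ (+ p)))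
        where
        identity : ∀ a c u v u′ v′ p → (+ 8 * c * u′ - a * v′) * p
          ≡ (p * v) * p + (+ 8 * c) * (u′ * p - (a * u + + 27 * c * v)) + (- a) * (v′ * p - (+ 8 * c * u - a * v))
            + v * ((a * a + + 216 * (c * c)) - p * p)
        identity = solve-∀

      Q[u′,v′]≡pm : Q u′ v′ ≡ + p * + m
      Q[u′,v′]≡pm = ℤₚ.*-cancelˡ-≡ (+ p * + p) (Q u′ v′) (+ p * + m) {{ℤₚ.i*j≢0 (+ p) (+ p)}}
        (linear-combination₄ u′*p≡X v′*p≡Y (±b-square c≡±b) (Q≡p*m {u} {v} h)
          (+ 8 * (u′ * + p + X c u v)) (+ 27 * (v′ * + p + Y c u v)) (Q u v) (+ p * + p)
          (identity a c u v u′ v′ (+ p) (+ m)))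
        where
        identity : ∀ a c u v u′ v′ p m → (p * p) * (+ 8 * (u′ * u′) + + 27 * (v′ * v′))
          ≡ (p * p) * (p * m) + (+ 8 * (u′ * p + (a * u + + 27 * c * v))) * (u′ * p - (a * u + + 27 * c * v))
            + (+ 27 * (v′ * p + (+ 8 * c * u - a * v))) * (v′ * p - (+ 8 * c * u - a * v))
            + (+ 8 * (u * u) + + 27 * (v * v)) * ((a * a + + 216 * (c * c)) - p * p)
            + (p * p) * ((+ 8 * (u * u) + + 27 * (v * v)) - p * m)
        identity = solve-∀

      u′⊥v′ : Coprime ∣ u′ ∣ ∣ v′ ∣
      u′⊥v′ {i} (i∣u′ , i∣v′) with prime⇒irreducible p-prime (ℕgcd.gcd[m,n]∣n i p)
      ... | inj₁ gcd[i,p]≡1 = ℕ∣.∣1⇒≡1 (subst (i ℕ∣.∣_) (ℤₚ.+-injective (proj₂ h))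
            (ℕgcd.gcd-greatest (Coprimality.coprime-divisor i⊥p i∣pu) (Coprimality.coprime-divisor i⊥p i∣pv)))
        where
        i⊥p : Coprime i p
        i⊥p = Coprimality.gcd≡1⇒coprime gcd[i,p]≡1
        i∣X : + i ∣ℤ X c u′ v′
        i∣X = ℤ∣.∣m∣n⇒∣m+n (ℤ∣.∣n⇒∣m*n a (ℤ∣.∣ᵤ⇒∣ i∣u′)) (ℤ∣.∣n⇒∣m*n (+ 27 * c) (ℤ∣.∣ᵤ⇒∣ i∣v′))
        i∣Y : + i ∣ℤ Y c u′ v′
        i∣Y = ℤ∣.∣m∣n⇒∣m-n (ℤ∣.∣n⇒∣m*n (+ 8 * c) (ℤ∣.∣ᵤ⇒∣ i∣u′)) (ℤ∣.∣n⇒∣m*n a (ℤ∣.∣ᵤ⇒∣ i∣v′))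
        i∣pu : i ℕ∣.∣ p ℕ.* ∣ u ∣
        i∣pu = subst (i ℕ∣.∣_) (ℤₚ.abs-* (+ p) u) (ℤ∣.∣⇒∣ᵤ (subst (+ i ∣ℤ_) X[u′,v′]≡p*u i∣X))
        i∣pv : i ℕ∣.∣ p ℕ.* ∣ v ∣
        i∣pv = subst (i ℕ∣.∣_) (ℤₚ.abs-* (+ p) v) (ℤ∣.∣⇒∣ᵤ (subst (+ i ∣ℤ_) Y[u′,v′]≡p*v i∣Y))
      ... | inj₂ gcd[i,p]≡p = ⊥-elim (Q≡pm⇒¬[p∣x×p∣y] Q[u′,v′]≡pm (p∣ {u′} i∣u′) (p∣ {v′} i∣v′))
        where
        p∣ : ∀ {w} → i ℕ∣.∣ ∣ w ∣ → + p ∣ℤ w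
        p∣ i∣w = ℤ∣.∣ᵤ⇒∣ (ℕ∣.∣-trans (subst (ℕ∣._∣ i) gcd[i,p]≡p (ℕgcd.gcd[m,n]∣m i p)) i∣w)

      image∈U : InU (u′ , v′)
      image∈U = trans Q[u′,v′]≡pm (sym (ℤₚ.pos-* p m)) , cong +_ (Coprimality.coprime⇒gcd≡1 u′⊥v′)

    σ∈U : ∀ {z} → InU z → InU (σ z)
    σ∈U {u , v} h = go (admissible {u} {v} h)
      where
      go : ∃ (Admissible u v) → InU (σ (u , v))
      go (c , c≡±b , p∣X) = subst InU (sym (σ≡σ[c] {c} {u} {v} c≡±b h p∣X)) (Image.image∈U c≡±b h p∣X)

    σ-involutive : ∀ {z} → InU z → σ (σ z) ≡ z
    σ-involutive {u , v} h = go (admissible {u} {v} h)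
      where
      go : ∃ (Admissible u v) → σ (σ (u , v)) ≡ (u , v)
      go (c , c≡±b , p∣X) = begin
        σ (σ (u , v))           ≡⟨ cong σ (σ≡σ[c] {c} {u} {v} c≡±b h p∣X) ⟩
        σ (u′ , v′)             ≡⟨ σ≡σ[c] {c} {u′} {v′} c≡±b image∈U p∣X′ ⟩
        σ[ c ] (u′ , v′)        ≡⟨ cong₂ _,_ (quot-unique (trans X[u′,v′]≡p*u (ℤₚ.*-comm (+ p) u)))
                                             (quot-unique (trans Y[u′,v′]≡p*v (ℤₚ.*-comm (+ p) v))) ⟩
        (u , v)                 ∎
        where
        open Image c≡±b h p∣X
        open ≡-Reasoning
        p∣X′ : + p ∣ℤ X c u′ v′
        p∣X′ = subst (+ p ∣ℤ_) (sym X[u′,v′]≡p*u) (p∣p*i u)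

    p∣-cong-abs : ∀ {z z′} → + p ∣ℤ z → ∣ z′ ∣ ≡ ∣ z ∣ → + p ∣ℤ z′
    p∣-cong-abs p∣z ∣z′∣≡∣z∣ = ℤ∣.∣ᵤ⇒∣ (subst (p ℕ∣.∣_) (sym ∣z′∣≡∣z∣) (ℤ∣.∣⇒∣ᵤ p∣z))

    abs²-σ-cong : ∀ {u v u′ v′ c c′} → c ≡± b → c′ ≡± b → InU (u , v) → InU (u′ , v′) → + p ∣ℤ X c u v
      → ∣ X c′ u′ v′ ∣ ≡ ∣ X c u v ∣ → ∣ Y c′ u′ v′ ∣ ≡ ∣ Y c u v ∣ → abs² (σ (u′ , v′)) ≡ abs² (σ (u , v))
    abs²-σ-cong {u} {v} {u′} {v′} {c} {c′} c≡±b c′≡±b h h′ p∣X ∣X′∣≡∣X∣ ∣Y′∣≡∣Y∣ = begin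
      abs² (σ (u′ , v′))          ≡⟨ cong abs² (σ≡σ[c] {c′} {u′} {v′} c′≡±b h′ p∣X′) ⟩
      abs² (σ[ c′ ] (u′ , v′))    ≡⟨ cong₂ (λ s t → + s , + t) (∣quot∣-cong p∣X′ p∣X ∣X′∣≡∣X∣)
                                                               (∣quot∣-cong p∣Y′ p∣Y ∣Y′∣≡∣Y∣) ⟩
      abs² (σ[ c ] (u , v))       ≡⟨ cong abs² (σ≡σ[c] {c} {u} {v} c≡±b h p∣X) ⟨
      abs² (σ (u , v))            ∎
      where
      open ≡-Reasoning
      p∣X′ : + p ∣ℤ X c′ u′ v′
      p∣X′ = p∣-cong-abs p∣X ∣X′∣≡∣X∣
      p∣Y : + p ∣ℤ Y c u v
      p∣Y = p∣X⇒p∣Y c≡±b p∣X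
      p∣Y′ : + p ∣ℤ Y c′ u′ v′
      p∣Y′ = p∣X⇒p∣Y c′≡±b p∣X′

    abs²-σ-abs² : ∀ z → InU z → abs² (σ (abs² z)) ≡ abs² (σ z)
    abs²-σ-abs² (u , v) h = go u v h (admissible {u} {v} h)
      where
      i≡-j⇒∣i∣≡∣j∣ : ∀ {i j} → i ≡ - j → ∣ i ∣ ≡ ∣ j ∣
      i≡-j⇒∣i∣≡∣j∣ {j = j} i≡-j = trans (cong ∣_∣ i≡-j) (ℤₚ.∣-i∣≡∣i∣ j)
      X[-c,u,-v] : ∀ a c u v → a * u + + 27 * (- c) * (- v) ≡ a * u + + 27 * c * v
      X[-c,u,-v] = solve-∀
      Y[-c,u,-v] : ∀ a c u v → + 8 * (- c) * u - a * (- v) ≡ - (+ 8 * c * u - a * v)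
      Y[-c,u,-v] = solve-∀
      X[-c,-u,v] : ∀ a c u v → a * (- u) + + 27 * (- c) * v ≡ - (a * u + + 27 * c * v)
      X[-c,-u,v] = solve-∀
      Y[-c,-u,v] : ∀ a c u v → + 8 * (- c) * (- u) - a * v ≡ + 8 * c * u - a * v
      Y[-c,-u,v] = solve-∀
      X[c,-u,-v] : ∀ a c u v → a * (- u) + + 27 * c * (- v) ≡ - (a * u + + 27 * c * v)
      X[c,-u,-v] = solve-∀
      Y[c,-u,-v] : ∀ a c u v → + 8 * c * (- u) - a * (- v) ≡ - (+ 8 * c * u - a * v)
      Y[c,-u,-v] = solve-∀
      go : ∀ u v → InU (u , v) → ∃ (Admissible u v) → abs² (σ (abs² (u , v))) ≡ abs² (σ (u , v))
      go (+ _) (+ _) _ _ = refl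
      go u@(+ _) v@(-[1+ _ ]) h (c , c≡±b , p∣X) =
        abs²-σ-cong {u} {v} {u} { - v} c≡±b (±b-neg c≡±b) h (PrimRep-negʳ {_} {u} {v} h) p∣X
          (cong ∣_∣ (X[-c,u,-v] a c u v)) (i≡-j⇒∣i∣≡∣j∣ (Y[-c,u,-v] a c u v))
      go u@(-[1+ _ ]) v@(+ _) h (c , c≡±b , p∣X) =
        abs²-σ-cong {u} {v} { - u} {v} c≡±b (±b-neg c≡±b) h (PrimRep-negˡ {_} {u} {v} h) p∣X
          (i≡-j⇒∣i∣≡∣j∣ (X[-c,-u,v] a c u v)) (cong ∣_∣ (Y[-c,-u,v] a c u v))
      go u@(-[1+ _ ]) v@(-[1+ _ ]) h (c , c≡±b , p∣X) =
        abs²-σ-cong {u} {v} { - u} { - v} c≡±b c≡±b h (PrimRep-negʳ {_} { - u} {v} (PrimRep-negˡ {_} {u} {v} h)) p∣X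
          (i≡-j⇒∣i∣≡∣j∣ (X[c,-u,-v] a c u v)) (i≡-j⇒∣i∣≡∣j∣ (Y[c,-u,-v] a c u v))

    InU⇒v≢0 : ∀ {u v} → InU (u , v) → v ≢ 0ℤ
    InU⇒v≢0 {u} h refl = p∤8 (subst (p ℕ∣.∣_) (PrimRep[u,0]⇒N≡8 {p ℕ.* m} {u} h) (ℕ∣.m∣m*n m))

    ±b≢0 : ∀ {c} → c ≡± b → c ≢ 0ℤ
    ±b≢0 (inj₁ refl) = b≢0
    ±b≢0 (inj₂ refl) -b≡0 = b≢0 (trans (sym (ℤₚ.neg-involutive b)) (cong -_ -b≡0))

    a≡±p⇒c≡0 : ∀ {c} → c ≡± b → (+ p - a) * (+ p + a) ≡ 0ℤ → ⊥
    a≡±p⇒c≡0 {c} c≡±b [p-a][p+a]≡0 = i≢0⇒j≢0⇒i*j≢0 {+ 216} (λ ()) (i≢0⇒j≢0⇒i*j≢0 c≢0 c≢0)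
      (linear-combination₂ (±b-square c≡±b) [p-a][p+a]≡0 (+ 1) (+ 1) (identity a c (+ p)))
      where
      c≢0 : c ≢ 0ℤ
      c≢0 = ±b≢0 c≡±b
      identity : ∀ a c p → + 216 * (c * c)
        ≡ 0ℤ + + 1 * ((a * a + + 216 * (c * c)) - p * p) + + 1 * ((p - a) * (p + a) - 0ℤ)
      identity = solve-∀

    module _ (m⊥2 : Coprime m 2) (m⊥3 : Coprime m 3) where

      X≡up⇒Y≡vp⇒m≡1 : ∀ {c u v} → c ≡± b → InU (u , v) → X c u v ≡ u * + p → Y c u v ≡ v * + p → m ≡ 1
      X≡up⇒Y≡vp⇒m≡1 {c} {u} {v} c≡±b h X≡up Y≡vp = coprime-6∧∣16u²∧∣54v²⇒≡1 {m} {∣ u ∣} {∣ v ∣} m⊥2 m⊥3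
        (Coprimality.gcd≡1⇒coprime (ℤₚ.+-injective (proj₂ h)))
        (m*i≡k*j*j⇒m∣k*∣j∣*∣j∣ 16 (a + + p) u (ℤₚ.*-cancelˡ-≡ (+ p) _ _
          (linear-combination₃ X≡up Y≡vp (Q≡p*m {u} {v} h) (+ 8 * u) (- (+ 27 * v)) (- (a + + p))
            (identity₁ a c u v (+ p) (+ m)))))
        (m*i≡k*j*j⇒m∣k*∣j∣*∣j∣ 54 (+ p - a) v (ℤₚ.*-cancelˡ-≡ (+ p) _ _
          (linear-combination₃ X≡up Y≡vp (Q≡p*m {u} {v} h) (- (+ 8 * u)) (+ 27 * v) (- (+ p - a))
            (identity₂ a c u v (+ p) (+ m)))))
        where
        identity₁ : ∀ a c u v p m → p * (m * (a + p)) ≡ p * (+ 16 * (u * u))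
          + (+ 8 * u) * ((a * u + + 27 * c * v) - u * p) + (- (+ 27 * v)) * ((+ 8 * c * u - a * v) - v * p)
          + (- (a + p)) * ((+ 8 * (u * u) + + 27 * (v * v)) - p * m)
        identity₁ = solve-∀
        identity₂ : ∀ a c u v p m → p * (m * (p - a)) ≡ p * (+ 54 * (v * v))
          + (- (+ 8 * u)) * ((a * u + + 27 * c * v) - u * p) + (+ 27 * v) * ((+ 8 * c * u - a * v) - v * p)
          + (- (p - a)) * ((+ 8 * (u * u) + + 27 * (v * v)) - p * m)
        identity₂ = solve-∀

      X≡-up⇒Y≡-vp⇒m≡1 : ∀ {c u v} → c ≡± b → InU (u , v) → X c u v ≡ (- u) * + p → Y c u v ≡ (- v) * + p → m ≡ 1
      X≡-up⇒Y≡-vp⇒m≡1 {c} {u} {v} c≡±b h X≡-up Y≡-vp = coprime-6∧∣16u²∧∣54v²⇒≡1 {m} {∣ u ∣} {∣ v ∣} m⊥2 m⊥3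
        (Coprimality.gcd≡1⇒coprime (ℤₚ.+-injective (proj₂ h)))
        (m*i≡k*j*j⇒m∣k*∣j∣*∣j∣ 16 (+ p - a) u (ℤₚ.*-cancelˡ-≡ (+ p) _ _
          (linear-combination₃ X≡-up Y≡-vp (Q≡p*m {u} {v} h) (- (+ 8 * u)) (+ 27 * v) (- (+ p - a))
            (identity₁ a c u v (+ p) (+ m)))))
        (m*i≡k*j*j⇒m∣k*∣j∣*∣j∣ 54 (a + + p) v (ℤₚ.*-cancelˡ-≡ (+ p) _ _
          (linear-combination₃ X≡-up Y≡-vp (Q≡p*m {u} {v} h) (+ 8 * u) (- (+ 27 * v)) (- (a + + p))
            (identity₂ a c u v (+ p) (+ m)))))
        where
        identity₁ : ∀ a c u v p m → p * (m * (p - a)) ≡ p * (+ 16 * (u * u))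
          + (- (+ 8 * u)) * ((a * u + + 27 * c * v) - (- u) * p) + (+ 27 * v) * ((+ 8 * c * u - a * v) - (- v) * p)
          + (- (p - a)) * ((+ 8 * (u * u) + + 27 * (v * v)) - p * m)
        identity₁ = solve-∀
        identity₂ : ∀ a c u v p m → p * (m * (a + p)) ≡ p * (+ 54 * (v * v))
          + (+ 8 * u) * ((a * u + + 27 * c * v) - (- u) * p) + (- (+ 27 * v)) * ((+ 8 * c * u - a * v) - (- v) * p)
          + (- (a + p)) * ((+ 8 * (u * u) + + 27 * (v * v)) - p * m)
        identity₂ = solve-∀

      2p[p+ε]v≡0⇒⊥ : ∀ {c v} → c ≡± b → v ≢ 0ℤ → ∀ ε → ε ≡ - a ⊎ ε ≡ a → (+ 2 * + p) * ((+ p + ε) * v) ≡ 0ℤ → ⊥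
      2p[p+ε]v≡0⇒⊥ {c} {v} c≡±b v≢0 ε ε≡∓a eq = a≡±p⇒c≡0 c≡±b ([ p-a≡0⇒ , p+a≡0⇒ ] ε≡∓a)
        where
        p+ε≡0 : + p + ε ≡ 0ℤ
        p+ε≡0 = [ (λ p+ε≡0 → p+ε≡0) , (λ v≡0 → ⊥-elim (v≢0 v≡0)) ]
          (ℤₚ.i*j≡0⇒i≡0∨j≡0 (+ p + ε) (i*j≡0⇒i≢0⇒j≡0 eq (i≢0⇒j≢0⇒i*j≢0 {+ 2} (λ ()) +p≢0)))
        p-a≡0⇒ : ε ≡ - a → (+ p - a) * (+ p + a) ≡ 0ℤ
        p-a≡0⇒ refl = trans (cong (_* (+ p + a)) p+ε≡0) (ℤₚ.*-zeroˡ (+ p + a))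
        p+a≡0⇒ : ε ≡ a → (+ p - a) * (+ p + a) ≡ 0ℤ
        p+a≡0⇒ refl = trans (cong ((+ p - a) *_) p+ε≡0) (ℤₚ.*-zeroʳ (+ p - a))

      ¬[X≡up×Y≡-vp] : ∀ {c u v} → c ≡± b → InU (u , v) → X c u v ≡ u * + p → Y c u v ≡ (- v) * + p → ⊥
      ¬[X≡up×Y≡-vp] {c} {u} {v} c≡±b h X≡up Y≡-vp = 2p[p+ε]v≡0⇒⊥ c≡±b (InU⇒v≢0 {u} {v} h) (- a) (inj₁ refl)
        (linear-combination₃ X≡up Y≡-vp (±b-square c≡±b) (+ 8 * c) (- (a - + p)) (- v) (identity a c u v (+ p)))
        where
        identity : ∀ a c u v p → (+ 2 * p) * ((p + - a) * v) ≡ 0ℤ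
          + (+ 8 * c) * ((a * u + + 27 * c * v) - u * p) + (- (a - p)) * ((+ 8 * c * u - a * v) - (- v) * p)
          + (- v) * ((a * a + + 216 * (c * c)) - p * p)
        identity = solve-∀

      ¬[X≡-up×Y≡vp] : ∀ {c u v} → c ≡± b → InU (u , v) → X c u v ≡ (- u) * + p → Y c u v ≡ v * + p → ⊥
      ¬[X≡-up×Y≡vp] {c} {u} {v} c≡±b h X≡-up Y≡vp = 2p[p+ε]v≡0⇒⊥ c≡±b (InU⇒v≢0 {u} {v} h) a (inj₂ refl)
        (linear-combination₃ X≡-up Y≡vp (±b-square c≡±b) (+ 8 * c) (- (a + + p)) (- v) (identity a c u v (+ p)))
        where
        identity : ∀ a c u v p → (+ 2 * p) * ((p + a) * v) ≡ 0ℤ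
          + (+ 8 * c) * ((a * u + + 27 * c * v) - (- u) * p) + (- (a + p)) * ((+ 8 * c * u - a * v) - v * p)
          + (- v) * ((a * a + + 216 * (c * c)) - p * p)
        identity = solve-∀

      ∣σ₁∣≡∣u∣⇒m≡1 : ∀ {u v} → InU (u , v) → ∣ proj₁ (σ (u , v)) ∣ ≡ ∣ u ∣ → m ≡ 1
      ∣σ₁∣≡∣u∣⇒m≡1 {u} {v} h ∣σ₁∣≡∣u∣ = go (admissible {u} {v} h)
        where
        go : ∃ (Admissible u v) → m ≡ 1
        go (c , c≡±b , p∣X) = cases (∣i∣≡∣j∣⇒i≡j∨i≡-j u′ u ∣u′∣≡∣u∣) (∣i∣≡∣j∣⇒i≡j∨i≡-j v′ v ∣v′∣≡∣v∣)
          where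
          open Image c≡±b h p∣X
          ∣u′∣≡∣u∣ : ∣ u′ ∣ ≡ ∣ u ∣
          ∣u′∣≡∣u∣ = subst (λ z → ∣ proj₁ z ∣ ≡ ∣ u ∣) (σ≡σ[c] {c} {u} {v} c≡±b h p∣X) ∣σ₁∣≡∣u∣
          ∣v′∣≡∣v∣ : ∣ v′ ∣ ≡ ∣ v ∣
          ∣v′∣≡∣v∣ = PrimRep-∣u∣⇒∣v∣ {p ℕ.* m} {u} {v} {u′} {v′} h image∈U ∣u′∣≡∣u∣
          X≡ : ∀ {w} → u′ ≡ w → X c u v ≡ w * + p
          X≡ u′≡w = trans (sym u′*p≡X) (cong (_* + p) u′≡w)
          Y≡ : ∀ {w} → v′ ≡ w → Y c u v ≡ w * + p
          Y≡ v′≡w = trans (sym v′*p≡Y) (cong (_* + p) v′≡w)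
          cases : u′ ≡ u ⊎ u′ ≡ - u → v′ ≡ v ⊎ v′ ≡ - v → m ≡ 1
          cases (inj₁ u′≡u) (inj₁ v′≡v) = X≡up⇒Y≡vp⇒m≡1 c≡±b h (X≡ u′≡u) (Y≡ v′≡v)
          cases (inj₂ u′≡-u) (inj₂ v′≡-v) = X≡-up⇒Y≡-vp⇒m≡1 c≡±b h (X≡ u′≡-u) (Y≡ v′≡-v)
          cases (inj₁ u′≡u) (inj₂ v′≡-v) = ⊥-elim (¬[X≡up×Y≡-vp] c≡±b h (X≡ u′≡u) (Y≡ v′≡-v))
          cases (inj₂ u′≡-u) (inj₁ v′≡v) = ⊥-elim (¬[X≡-up×Y≡vp] c≡±b h (X≡ u′≡-u) (Y≡ v′≡v))

      module _ (1<m : 1 ℕ.< m) where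
        open Signs (p ℕ.* m) (p*m≢8 m) (p*m≢27 m)

        ι : U₊ → U₊
        ι ((s , t) , h) = positive (σ (+ suc s , + suc t)) (σ∈U {+ suc s , + suc t} h)

        toℤ²-ι : ∀ w → toℤ² (ι w) ≡ abs² (σ (toℤ² w))
        toℤ²-ι ((s , t) , h) = toℤ²-positive (σ (+ suc s , + suc t)) (σ∈U {+ suc s , + suc t} h)

        abs²-σ-toℤ²-ι : ∀ w → abs² (σ (toℤ² (ι w))) ≡ toℤ² w
        abs²-σ-toℤ²-ι w@((s , t) , h) = begin
          abs² (σ (toℤ² (ι w)))          ≡⟨ cong (abs² ∘ σ) (toℤ²-ι w) ⟩
          abs² (σ (abs² (σ (toℤ² w))))   ≡⟨ abs²-σ-abs² (σ (toℤ² w)) (σ∈U {toℤ² w} h) ⟩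
          abs² (σ (σ (toℤ² w)))          ≡⟨ cong abs² (σ-involutive {toℤ² w} h) ⟩
          toℤ² w                         ∎
          where open ≡-Reasoning

        ι-involutive : ∀ w → ι (ι w) ≡ w
        ι-involutive w = toℤ²-injective (trans (toℤ²-ι (ι w)) (abs²-σ-toℤ²-ι w))

        ∣u∣ : U₊ → ℕ
        ∣u∣ w = ∣ proj₁ (toℤ² w) ∣

        ∣σ₁∣ : U₊ → ℕ
        ∣σ₁∣ w = ∣ proj₁ (σ (toℤ² w)) ∣

        Smaller : U₊ → Set
        Smaller w = ∣u∣ w ℕ.< ∣σ₁∣ w

        ∣u∣-ι : ∀ w → ∣u∣ (ι w) ≡ ∣σ₁∣ w
        ∣u∣-ι w = cong (∣_∣ ∘ proj₁) (toℤ²-ι w)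

        ∣σ₁∣-ι : ∀ w → ∣σ₁∣ (ι w) ≡ ∣u∣ w
        ∣σ₁∣-ι w = cong (∣_∣ ∘ proj₁) (abs²-σ-toℤ²-ι w)

        Smaller⇒¬Smaller-ι : ∀ w → Smaller w → ¬ Smaller (ι w)
        Smaller⇒¬Smaller-ι w u<σ₁ σ₁<u = ℕₚ.<-asym u<σ₁ (subst₂ ℕ._<_ (∣u∣-ι w) (∣σ₁∣-ι w) σ₁<u)

        ¬Smaller⇒Smaller-ι : ∀ w → ¬ Smaller w → Smaller (ι w)
        ¬Smaller⇒Smaller-ι w@((s , t) , h) u≮σ₁ = subst₂ ℕ._<_ (sym (∣u∣-ι w)) (sym (∣σ₁∣-ι w))
          (ℕₚ.≤∧≢⇒< (ℕₚ.≮⇒≥ u≮σ₁) (λ σ₁≡u → ℕₚ.<⇒≢ 1<m (sym (∣σ₁∣≡∣u∣⇒m≡1 {+ suc s} {+ suc t} h σ₁≡u))))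

        U↔Fin[8k] : ∃ λ k → U p m ↔ Fin (8 ℕ.* k)
        U↔Fin[8k] = k , subst (λ n → U p m ↔ Fin n) (2[2[2k]]≡8k k)
          (↔-trans U↔signs×U₊ (Bool×-↔-Fin (Bool×-↔-Fin
            (↔-trans U₊↔Bool×Smaller (Bool×-↔-Fin Smaller↔Fin)))))
          where
          Smaller-finite : Finite (Σ U₊ Smaller)
          Smaller-finite = Σ-finite U₊-finite (λ w → ∣u∣ w ℕₚ.<? ∣σ₁∣ w) (λ w → ℕₚ.<-irrelevant)
          k : ℕ
          k = proj₁ Smaller-finite
          Smaller↔Fin : Σ U₊ Smaller ↔ Fin k
          Smaller↔Fin = proj₂ Smaller-finite
          U₊↔Bool×Smaller : U₊ ↔ (Bool × Σ U₊ Smaller)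
          U₊↔Bool×Smaller = involution⇒↔Bool×Σ {P = Smaller} (λ w → ℕₚ.<-irrelevant)
            (λ w → ∣u∣ w ℕₚ.<? ∣σ₁∣ w) ι ι-involutive Smaller⇒¬Smaller-ι ¬Smaller⇒Smaller-ι
          2[2[2k]]≡8k : ∀ k → 2 ℕ.* (2 ℕ.* (2 ℕ.* k)) ≡ 8 ℕ.* k
          2[2[2k]]≡8k = ℕsolve-∀

open import Data.Nat.Base using (_*_; _%_; _>_)
open import Data.Nat.Divisibility using (_∣_)

corollary2p6 : (p j m : ℕ) → Prime p → p % 2 ≡ 1
    → (j ≡ 1 ⊎ j ≡ 4 ⊎ j ≡ 8)
    → Σ (ℤ × ℤ) (PrimRep (j * p))
    → m > 0 → ¬ (p ∣ m) → (p * m) % 24 ≡ 11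
    → (m > 1 → ∃ λ k → U p m ↔ Fin (8 * k))
      × (m ≡ 1 → U p 1 ↔ Fin 4)
corollary2p6 p j m p-prime _ j∈148 ((x , y) , h) _ p∤m pm%24≡11 = U-count-m>1 , U-count-m≡1
  where
  pm⊥2 : Coprime (p * m) 2
  pm⊥2 = n%24≡11⇒coprime-2 pm%24≡11
  pm⊥3 : Coprime (p * m) 3
  pm⊥3 = n%24≡11⇒coprime-3 pm%24≡11
  p∤2 : ¬ p ∣ 2
  p∤2 p∣2 = ¬prime[1] (subst Prime (pm⊥2 (ℕ∣.m∣m*n m , p∣2)) p-prime)
  p∤3 : ¬ p ∣ 3
  p∤3 p∣3 = ¬prime[1] (subst Prime (pm⊥3 (ℕ∣.m∣m*n m , p∣3)) p-prime)
  m⊥2 : Coprime m 2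
  m⊥2 (d∣m , d∣2) = pm⊥2 (ℕ∣.∣n⇒∣m*n p d∣m , d∣2)
  m⊥3 : Coprime m 3
  m⊥3 (d∣m , d∣3) = pm⊥3 (ℕ∣.∣n⇒∣m*n p d∣m , d∣3)
  U-count-m>1 : m > 1 → ∃ λ k → U p m ↔ Fin (8 * k)
  U-count-m>1 = Involution.U↔Fin[8k] p-prime p∤2 p∤3 p∤m
    (PrimRep[j*p]⇒SquareRep p-prime p∤2 p∤3 j∈148 x y h) m⊥2 m⊥3
  U-count-m≡1 : m ≡ 1 → U p 1 ↔ Fin 4
  U-count-m≡1 refl = PrimRep[j*p]⇒U[p,1]↔Fin4 p-prime p∤2 p∤3 (trans (cong (_% 24) (sym (ℕₚ.*-identityʳ p))) pm%24≡11)
    j∈148 x y h
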